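{- Let $k$ be a positive integer and $n\ge 0$ an integer. Then $$F_{n,k}(q):=\prod_{m=1}^{n}\frac{(1-q^{km})(1-q^{k(m-1)+1})}{(1-q^m)^2}$$ is a polynomial in $q$ with integer coefficients.
   Context: The empty product equals $1$. -}

module Defs where

open import Data.Nat using (ℕ; zero; suc)
import Data.Nat as ℕ
open import Data.Integer using (ℤ; +_; -_; _+_; _*_)
open import Data.List using (List; []; _∷_; map; replicate; _++_)
open import Relation.Binary.PropositionalEquality using (_≡_)

-- Polynomials in q with integer coefficients, as coefficient lists
-- (constant term first). Trailing zeros are allowed; equality of
-- polynomials is coefficientwise (see _≈ₚ_).
Poly : Set
Poly = List ℤ

coeff : Poly → ℕ → ℤ
coeff []       _       = + 0
coeff (a ∷ p)  zero    = a
coeff (a ∷ p)  (suc i) = coeff p i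

infix 4 _≈ₚ_
_≈ₚ_ : Poly → Poly → Set
p ≈ₚ r = ∀ i → coeff p i ≡ coeff r i

infixl 6 _+ₚ_
_+ₚ_ : Poly → Poly → Poly
[]      +ₚ r       = r
(a ∷ p) +ₚ []      = a ∷ p
(a ∷ p) +ₚ (b ∷ r) = (a + b) ∷ (p +ₚ r)

negₚ : Poly → Poly
negₚ = map -_

infixl 7 _*ₚ_
_*ₚ_ : Poly → Poly → Poly
[]      *ₚ r = []
(a ∷ p) *ₚ r = map (a *_) r +ₚ (+ 0 ∷ (p *ₚ r))

oneₚ : Poly
oneₚ = + 1 ∷ []

qpow : ℕ → Poly
qpow m = replicate m (+ 0) ++ (+ 1 ∷ [])

oneMinusQpow : ℕ → Poly
oneMinusQpow m = oneₚ +ₚ negₚ (qpow m)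

prodFrom1 : ℕ → (ℕ → Poly) → Poly
prodFrom1 zero    f = oneₚ
prodFrom1 (suc n) f = prodFrom1 n f *ₚ f (suc n)

numer : ℕ → ℕ → Poly
numer n k = prodFrom1 n (λ m →
  oneMinusQpow (k ℕ.* m) *ₚ oneMinusQpow (k ℕ.* (m ℕ.∸ 1) ℕ.+ 1))

denom : ℕ → Poly
denom n = prodFrom1 n (λ m → oneMinusQpow m *ₚ oneMinusQpow m)

module Submission where

open import Defs
open import Data.Nat using (ℕ; _≤_)
open import Data.Product using (∃-syntax)
import Data.Nat as ℕ

-- The proof goes through cyclotomic polynomials.  After setting up ℤ[q] on
-- coefficient lists, we construct by recursion on N a family Φ_1, Φ_2, ...
-- with constant terms 1 and 1 - q^t = ∏_{d | t} Φ_d (module Cyclotomic):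
-- Φ_(N+1) is the quotient of 1 - q^(N+1) by the Φ_d of its proper divisors.
-- This division works because distinct Φ_d are comaximal over ℤ (from the
-- separability of 1 - q^N and Bézout's identity for exponents), and because
-- an integer factor can be cancelled when dividing by a polynomial with
-- constant term 1.  A product of factors 1 - q^t is then ∏_d Φ_d^(number of
-- exponents t divisible by d), so divisibility of such products reduces to
-- comparing these counts (module Criterion), which for F_{n,k} is done on
-- blocks of d consecutive values of m (modules BlockSums and Counting).

module PolynomialRing where

  open import Data.Nat as ℕ using (zero; suc; _∸_; z≤n; s≤s)
  import Data.Nat.Properties as ℕP
  open import Data.Integer using (ℤ; +_; -_; _+_; _*_)
  import Data.Integer.Properties as ℤP
  open import Data.List using ([]; _∷_; map)
  open import Data.Product using (_,_)
  open import Data.Maybe using (Maybe; just; nothing)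
  open import Function using (_∘_)
  open import Relation.Binary.PropositionalEquality
  open import Algebra.Bundles using (CommutativeRing)
  import Relation.Binary.Reasoning.Setoid
  open import Algebra.Properties.CommutativeSemigroup ℤP.+-commutativeSemigroup
    using () renaming (interchange to +-interchange)
  open import Tactic.RingSolver.Core.AlmostCommutativeRing
    using (AlmostCommutativeRing; fromCommutativeRing)

  sumTo : (ℕ → ℤ) → ℕ → ℤ
  sumTo f zero    = f 0
  sumTo f (suc i) = f 0 + sumTo (f ∘ suc) i

  sumTo-cong : ∀ {f g} i → (∀ j → j ≤ i → f j ≡ g j) → sumTo f i ≡ sumTo g i
  sumTo-cong zero    h = h 0 z≤n
  sumTo-cong (suc i) h = cong₂ _+_ (h 0 z≤n) (sumTo-cong i (λ j j≤i → h (suc j) (s≤s j≤i)))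

  sumTo-snoc : ∀ f i → sumTo f (suc i) ≡ sumTo f i + f (suc i)
  sumTo-snoc f zero    = refl
  sumTo-snoc f (suc i) = trans (cong (_+_ (f 0)) (sumTo-snoc (f ∘ suc) i)) (sym (ℤP.+-assoc (f 0) _ _))

  sumTo-+ : ∀ f g i → sumTo (λ j → f j + g j) i ≡ sumTo f i + sumTo g i
  sumTo-+ f g zero    = refl
  sumTo-+ f g (suc i) = trans (cong (_+_ (f 0 + g 0)) (sumTo-+ (f ∘ suc) (g ∘ suc) i))
                              (+-interchange (f 0) (g 0) _ _)

  sumTo-*ˡ : ∀ c f i → sumTo (λ j → c * f j) i ≡ c * sumTo f i
  sumTo-*ˡ c f zero    = refl
  sumTo-*ˡ c f (suc i) = trans (cong (_+_ (c * f 0)) (sumTo-*ˡ c (f ∘ suc) i))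
                               (sym (ℤP.*-distribˡ-+ c (f 0) _))

  sumTo-zero : ∀ i → sumTo (λ _ → + 0) i ≡ + 0
  sumTo-zero zero    = refl
  sumTo-zero (suc i) = trans (ℤP.+-identityˡ _) (sumTo-zero i)

  -- summing in reverse order: the symmetry behind commutativity of *ₚ
  sumTo-reverse : ∀ f i → sumTo f i ≡ sumTo (λ j → f (i ∸ j)) i
  sumTo-reverse f zero    = refl
  sumTo-reverse f (suc i) = begin
    f 0 + sumTo (f ∘ suc) i                              ≡⟨ cong (_+_ (f 0)) (sumTo-reverse (f ∘ suc) i) ⟩
    f 0 + sumTo (λ j → f (suc (i ∸ j))) i                ≡⟨ ℤP.+-comm (f 0) _ ⟩
    sumTo (λ j → f (suc (i ∸ j))) i + f 0                ≡⟨ cong₂ _+_ (sumTo-cong i λ j j≤i → cong f (sym (ℕP.+-∸-assoc 1 j≤i)))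
                                                                      (cong f (sym (ℕP.n∸n≡0 (suc i)))) ⟩
    sumTo (λ j → f (suc i ∸ j)) i + f (suc i ∸ suc i)    ≡⟨ sym (sumTo-snoc (λ j → f (suc i ∸ j)) i) ⟩
    sumTo (λ j → f (suc i ∸ j)) (suc i)                  ∎
    where open ≡-Reasoning

  coeff-+ : ∀ p r i → coeff (p +ₚ r) i ≡ coeff p i + coeff r i
  coeff-+ []      r       i       = sym (ℤP.+-identityˡ _)
  coeff-+ (a ∷ p) []      i       = sym (ℤP.+-identityʳ _)
  coeff-+ (a ∷ p) (b ∷ r) zero    = refl
  coeff-+ (a ∷ p) (b ∷ r) (suc i) = coeff-+ p r i

  coeff-neg : ∀ p i → coeff (negₚ p) i ≡ - coeff p i
  coeff-neg []      i       = refl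
  coeff-neg (a ∷ p) zero    = refl
  coeff-neg (a ∷ p) (suc i) = coeff-neg p i

  coeff-scale : ∀ a p i → coeff (map (a *_) p) i ≡ a * coeff p i
  coeff-scale a []      i       = sym (ℤP.*-zeroʳ a)
  coeff-scale a (b ∷ p) zero    = refl
  coeff-scale a (b ∷ p) (suc i) = coeff-scale a p i

  coeff-* : ∀ p r i → coeff (p *ₚ r) i ≡ sumTo (λ j → coeff p j * coeff r (i ∸ j)) i
  coeff-* []      r i       = sym (sumTo-zero i)
  coeff-* (a ∷ p) r zero    = trans (coeff-+ (map (a *_) r) (+ 0 ∷ (p *ₚ r)) 0)
                                    (trans (ℤP.+-identityʳ _) (coeff-scale a r 0))
  coeff-* (a ∷ p) r (suc i) = trans (coeff-+ (map (a *_) r) (+ 0 ∷ (p *ₚ r)) (suc i))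
                                    (cong₂ _+_ (coeff-scale a r (suc i)) (coeff-* p r i))

  -- _≈ₚ_ wrapped in a record, so that both sides can be inferred from a proof
  infix 4 _≋_
  record _≋_ (p r : Poly) : Set where
    constructor mk
    field get : p ≈ₚ r
  open _≋_ public

  ≋-refl : ∀ {p} → p ≋ p
  ≋-refl = mk λ _ → refl

  ≋-sym : ∀ {p r} → p ≋ r → r ≋ p
  ≋-sym (mk h) = mk λ i → sym (h i)

  ≋-trans : ∀ {p r s} → p ≋ r → r ≋ s → p ≋ s
  ≋-trans (mk h) (mk g) = mk λ i → trans (h i) (g i)

  ≡⇒≋ : ∀ {p r} → p ≡ r → p ≋ r
  ≡⇒≋ refl = ≋-refl

  cons-cong : ∀ {a b p r} → a ≡ b → p ≋ r → (a ∷ p) ≋ (b ∷ r)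
  cons-cong a≡b (mk h) = mk λ { zero → a≡b ; (suc i) → h i }

  +-cong : ∀ {p p′ r r′} → p ≋ p′ → r ≋ r′ → p +ₚ r ≋ p′ +ₚ r′
  +-cong {p} {p′} {r} {r′} (mk h) (mk g) =
    mk λ i → trans (coeff-+ p r i) (trans (cong₂ _+_ (h i) (g i)) (sym (coeff-+ p′ r′ i)))

  neg-cong : ∀ {p p′} → p ≋ p′ → negₚ p ≋ negₚ p′
  neg-cong {p} {p′} (mk h) =
    mk λ i → trans (coeff-neg p i) (trans (cong -_ (h i)) (sym (coeff-neg p′ i)))

  *-cong : ∀ {p p′ r r′} → p ≋ p′ → r ≋ r′ → p *ₚ r ≋ p′ *ₚ r′
  *-cong {p} {p′} {r} {r′} (mk h) (mk g) = mk λ i → trans (coeff-* p r i)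
    (trans (sumTo-cong i λ j _ → cong₂ _*_ (h j) (g (i ∸ j))) (sym (coeff-* p′ r′ i)))

  +-comm : ∀ p r → p +ₚ r ≋ r +ₚ p
  +-comm p r = mk λ i → trans (coeff-+ p r i)
    (trans (ℤP.+-comm (coeff p i) (coeff r i)) (sym (coeff-+ r p i)))

  +-assoc : ∀ p r s → (p +ₚ r) +ₚ s ≋ p +ₚ (r +ₚ s)
  +-assoc p r s = mk λ i → begin
    coeff ((p +ₚ r) +ₚ s) i               ≡⟨ coeff-+ (p +ₚ r) s i ⟩
    coeff (p +ₚ r) i + coeff s i          ≡⟨ cong (_+ coeff s i) (coeff-+ p r i) ⟩
    coeff p i + coeff r i + coeff s i     ≡⟨ ℤP.+-assoc (coeff p i) _ _ ⟩
    coeff p i + (coeff r i + coeff s i)   ≡⟨ cong (_+_ (coeff p i)) (sym (coeff-+ r s i)) ⟩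
    coeff p i + coeff (r +ₚ s) i          ≡⟨ sym (coeff-+ p (r +ₚ s) i) ⟩
    coeff (p +ₚ (r +ₚ s)) i               ∎
    where open ≡-Reasoning

  +-identityʳ : ∀ p → p +ₚ [] ≋ p
  +-identityʳ p = mk λ i → trans (coeff-+ p [] i) (ℤP.+-identityʳ _)

  neg-inverseˡ : ∀ p → negₚ p +ₚ p ≋ []
  neg-inverseˡ p = mk λ i → trans (coeff-+ (negₚ p) p i)
    (trans (cong (_+ coeff p i) (coeff-neg p i)) (ℤP.+-inverseˡ (coeff p i)))

  *-comm : ∀ p r → p *ₚ r ≋ r *ₚ p
  *-comm p r = mk λ i → begin
    coeff (p *ₚ r) i                                      ≡⟨ coeff-* p r i ⟩
    sumTo (λ j → coeff p j * coeff r (i ∸ j)) i           ≡⟨ sumTo-reverse _ i ⟩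
    sumTo (λ j → coeff p (i ∸ j) * coeff r (i ∸ (i ∸ j))) i
      ≡⟨ sumTo-cong i (λ j j≤i → trans (cong (λ x → coeff p (i ∸ j) * coeff r x) (ℕP.m∸[m∸n]≡n j≤i))
                                        (ℤP.*-comm (coeff p (i ∸ j)) (coeff r j))) ⟩
    sumTo (λ j → coeff r j * coeff p (i ∸ j)) i           ≡⟨ sym (coeff-* r p i) ⟩
    coeff (r *ₚ p) i                                      ∎
    where open ≡-Reasoning

  *-distribˡ : ∀ p r s → p *ₚ (r +ₚ s) ≋ p *ₚ r +ₚ p *ₚ s
  *-distribˡ p r s = mk λ i → begin
    coeff (p *ₚ (r +ₚ s)) i
      ≡⟨ coeff-* p (r +ₚ s) i ⟩
    sumTo (λ j → coeff p j * coeff (r +ₚ s) (i ∸ j)) i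
      ≡⟨ sumTo-cong i (λ j _ → trans (cong (coeff p j *_) (coeff-+ r s (i ∸ j))) (ℤP.*-distribˡ-+ (coeff p j) _ _)) ⟩
    sumTo (λ j → coeff p j * coeff r (i ∸ j) + coeff p j * coeff s (i ∸ j)) i
      ≡⟨ sumTo-+ _ _ i ⟩
    sumTo (λ j → coeff p j * coeff r (i ∸ j)) i + sumTo (λ j → coeff p j * coeff s (i ∸ j)) i
      ≡⟨ sym (cong₂ _+_ (coeff-* p r i) (coeff-* p s i)) ⟩
    coeff (p *ₚ r) i + coeff (p *ₚ s) i
      ≡⟨ sym (coeff-+ (p *ₚ r) (p *ₚ s) i) ⟩
    coeff (p *ₚ r +ₚ p *ₚ s) i
      ∎
    where open ≡-Reasoning

  *-distribʳ : ∀ s p r → (p +ₚ r) *ₚ s ≋ p *ₚ s +ₚ r *ₚ s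
  *-distribʳ s p r = ≋-trans (*-comm (p +ₚ r) s)
    (≋-trans (*-distribˡ s p r) (+-cong (*-comm s p) (*-comm s r)))

  scale-*ˡ : ∀ a r s → map (a *_) r *ₚ s ≋ map (a *_) (r *ₚ s)
  scale-*ˡ a r s = mk λ i → begin
    coeff (map (a *_) r *ₚ s) i
      ≡⟨ coeff-* (map (a *_) r) s i ⟩
    sumTo (λ j → coeff (map (a *_) r) j * coeff s (i ∸ j)) i
      ≡⟨ sumTo-cong i (λ j _ → trans (cong (_* coeff s (i ∸ j)) (coeff-scale a r j)) (ℤP.*-assoc a _ _)) ⟩
    sumTo (λ j → a * (coeff r j * coeff s (i ∸ j))) i
      ≡⟨ sumTo-*ˡ a _ i ⟩
    a * sumTo (λ j → coeff r j * coeff s (i ∸ j)) i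
      ≡⟨ cong (a *_) (sym (coeff-* r s i)) ⟩
    a * coeff (r *ₚ s) i
      ≡⟨ sym (coeff-scale a (r *ₚ s) i) ⟩
    coeff (map (a *_) (r *ₚ s)) i
      ∎
    where open ≡-Reasoning

  shift-*ˡ : ∀ r s → (+ 0 ∷ r) *ₚ s ≋ + 0 ∷ (r *ₚ s)
  shift-*ˡ r s = mk λ i → trans (coeff-+ (map (+ 0 *_) s) (+ 0 ∷ (r *ₚ s)) i)
    (trans (cong (_+ coeff (+ 0 ∷ (r *ₚ s)) i) (coeff-scale (+ 0) s i)) (ℤP.+-identityˡ _))

  *-assoc : ∀ p r s → (p *ₚ r) *ₚ s ≋ p *ₚ (r *ₚ s)
  *-assoc []      r s = ≋-refl
  *-assoc (a ∷ p) r s = ≋-trans (*-distribʳ s (map (a *_) r) (+ 0 ∷ (p *ₚ r)))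
    (+-cong (scale-*ˡ a r s) (≋-trans (shift-*ˡ (p *ₚ r) s) (cons-cong refl (*-assoc p r s))))

  *-identityˡ : ∀ p → oneₚ *ₚ p ≋ p
  *-identityˡ p = mk λ i → trans (coeff-+ (map (+ 1 *_) p) (+ 0 ∷ []) i)
    (trans (cong₂ _+_ (coeff-scale (+ 1) p i) (coeff-zero i))
           (trans (ℤP.+-identityʳ _) (ℤP.*-identityˡ _)))
    where
    coeff-zero : ∀ i → coeff (+ 0 ∷ []) i ≡ + 0
    coeff-zero zero    = refl
    coeff-zero (suc i) = refl

  polyRing : CommutativeRing _ _
  polyRing = record
    { Carrier = Poly ; _≈_ = _≋_ ; _+_ = _+ₚ_ ; _*_ = _*ₚ_ ; -_ = negₚ ; 0# = [] ; 1# = oneₚ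
    ; isCommutativeRing = record
      { isRing = record
        { +-isAbelianGroup = record
          { isGroup = record
            { isMonoid = record
              { isSemigroup = record
                { isMagma = record
                  { isEquivalence = record { refl = ≋-refl ; sym = ≋-sym ; trans = ≋-trans }
                  ; ∙-cong = +-cong }
                ; assoc = +-assoc }
              ; identity = (λ _ → ≋-refl) , +-identityʳ }
            ; inverse = neg-inverseˡ , (λ p → ≋-trans (+-comm p (negₚ p)) (neg-inverseˡ p))
            ; ⁻¹-cong = neg-cong }
          ; comm = +-comm }
        ; *-cong = *-cong
        ; *-assoc = *-assoc
        ; *-identity = *-identityˡ , (λ p → ≋-trans (*-comm p oneₚ) (*-identityˡ p))
        ; distrib = *-distribˡ , *-distribʳ }
      ; *-comm = *-comm }
    }

  -- a sound (partial) zero test, used by the ring solver to recognise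
  -- constant polynomials such as oneₚ + negₚ oneₚ as zero
  zero? : (p : Poly) → Maybe ([] ≋ p)
  zero? []           = just ≋-refl
  zero? (+ zero ∷ p) with zero? p
  ... | just (mk e)  = just (mk λ { zero → refl ; (suc i) → e i })
  ... | nothing      = nothing
  zero? (_ ∷ p)      = nothing

  ℤ[q] : AlmostCommutativeRing _ _
  ℤ[q] = fromCommutativeRing polyRing zero?

  module ≋-Reasoning = Relation.Binary.Reasoning.Setoid (CommutativeRing.setoid polyRing)

  *-congˡ : ∀ x {a b} → a ≋ b → x *ₚ a ≋ x *ₚ b
  *-congˡ x = *-cong (≋-refl {x})

  *-congʳ : ∀ x {a b} → a ≋ b → a *ₚ x ≋ b *ₚ x
  *-congʳ x e = *-cong e (≋-refl {x})

  +-congˡ : ∀ x {a b} → a ≋ b → x +ₚ a ≋ x +ₚ b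
  +-congˡ x = +-cong (≋-refl {x})

  +-congʳ : ∀ x {a b} → a ≋ b → a +ₚ x ≋ b +ₚ x
  +-congʳ x e = +-cong e (≋-refl {x})

module PowersOfQ where

  open PolynomialRing
  open import Data.Nat as ℕ using (zero; suc)
  open import Data.Nat.Divisibility using (_∣_; divides)
  open import Data.Nat.GCD using (gcd; gcd-GCD; module Bézout)
  open import Data.Integer using (ℤ; +_; _*_)
  import Data.Integer.Properties as ℤP
  open import Data.List using ([]; _∷_; map)
  open import Data.Product using (_,_)
  open import Relation.Binary.PropositionalEquality using (_≡_; refl; sym; trans; cong)
  open import Tactic.RingSolver using (solve-∀)
  open ≋-Reasoning

  cst : ℤ → Poly
  cst a = a ∷ []

  qₚ : Poly
  qₚ = qpow 1

  cst-zero : cst (+ 0) ≋ []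
  cst-zero = mk λ { zero → refl ; (suc i) → refl }

  scale≋cst* : ∀ a p → map (a *_) p ≋ cst a *ₚ p
  scale≋cst* a p = ≋-sym (≋-trans (+-congˡ (map (a *_) p) cst-zero) (+-identityʳ (map (a *_) p)))

  coeff-cst* : ∀ a p i → coeff (cst a *ₚ p) i ≡ a * coeff p i
  coeff-cst* a p i = trans (sym (get (scale≋cst* a p) i)) (coeff-scale a p i)

  shift≋q* : ∀ p → + 0 ∷ p ≋ qₚ *ₚ p
  shift≋q* p = ≋-sym (≋-trans (shift-*ˡ (+ 1 ∷ []) p) (cons-cong refl (*-identityˡ p)))

  qpow-+ : ∀ a b → qpow (a ℕ.+ b) ≋ qpow a *ₚ qpow b
  qpow-+ zero    b = ≋-sym (*-identityˡ (qpow b))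
  qpow-+ (suc a) b = begin
    qpow (suc a ℕ.+ b)        ≈⟨ shift≋q* (qpow (a ℕ.+ b)) ⟩
    qₚ *ₚ qpow (a ℕ.+ b)      ≈⟨ *-congˡ qₚ (qpow-+ a b) ⟩
    qₚ *ₚ (qpow a *ₚ qpow b)  ≈⟨ ≋-sym (*-assoc qₚ (qpow a) (qpow b)) ⟩
    (qₚ *ₚ qpow a) *ₚ qpow b  ≈⟨ *-congʳ (qpow b) (≋-sym (shift≋q* (qpow a))) ⟩
    qpow (suc a) *ₚ qpow b    ∎

  oneMinusQpow-+ : ∀ a b → oneMinusQpow (a ℕ.+ b) ≋ oneMinusQpow a +ₚ qpow a *ₚ oneMinusQpow b
  oneMinusQpow-+ a b = ≋-trans (+-congˡ oneₚ (neg-cong (qpow-+ a b))) (expand (qpow a) (qpow b))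
    where
    expand : ∀ x y → oneₚ +ₚ negₚ (x *ₚ y) ≋ (oneₚ +ₚ negₚ x) +ₚ x *ₚ (oneₚ +ₚ negₚ y)
    expand = solve-∀ ℤ[q]

  infix 4 _∣ₚ_
  _∣ₚ_ : Poly → Poly → Set
  d ∣ₚ p = ∃[ r ] (r *ₚ d ≋ p)

  ∣ₚ-trans : ∀ {a b c} → a ∣ₚ b → b ∣ₚ c → a ∣ₚ c
  ∣ₚ-trans {a} (r , e) (s , f) = s *ₚ r , ≋-trans (*-assoc s r a) (≋-trans (*-congˡ s e) f)

  ∣ₚ-respʳ : ∀ {a b c} → b ≋ c → a ∣ₚ b → a ∣ₚ c
  ∣ₚ-respʳ f (r , e) = r , ≋-trans e f

  ∣ₚ-respˡ : ∀ {a b c} → a ≋ b → a ∣ₚ c → b ∣ₚ c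
  ∣ₚ-respˡ f (r , e) = r , ≋-trans (*-congˡ r (≋-sym f)) e

  one-∣ₚ : ∀ p → oneₚ ∣ₚ p
  one-∣ₚ p = p , ≋-trans (*-comm p oneₚ) (*-identityˡ p)

  -- geometric series: 1 - q^(b a) = (1 + q^a + ... + q^((b-1)a)) (1 - q^a)
  oneMinusQpow-multiple : ∀ a b → oneMinusQpow a ∣ₚ oneMinusQpow (b ℕ.* a)
  oneMinusQpow-multiple a zero    = [] , mk λ { zero → refl ; (suc i) → refl }
  oneMinusQpow-multiple a (suc b) with oneMinusQpow-multiple a b
  ... | g , e = oneₚ +ₚ qpow a *ₚ g , (begin
    (oneₚ +ₚ qpow a *ₚ g) *ₚ oneMinusQpow a              ≈⟨ regroup (oneMinusQpow a) (qpow a) g ⟩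
    oneMinusQpow a +ₚ qpow a *ₚ (g *ₚ oneMinusQpow a)    ≈⟨ +-congˡ (oneMinusQpow a) (*-congˡ (qpow a) e) ⟩
    oneMinusQpow a +ₚ qpow a *ₚ oneMinusQpow (b ℕ.* a)   ≈⟨ ≋-sym (oneMinusQpow-+ a (b ℕ.* a)) ⟩
    oneMinusQpow (a ℕ.+ b ℕ.* a)                         ∎)
    where
    regroup : ∀ o x g → (oneₚ +ₚ x *ₚ g) *ₚ o ≋ o +ₚ x *ₚ (g *ₚ o)
    regroup = solve-∀ ℤ[q]

  oneMinusQpow-∣ : ∀ {a b} → a ∣ b → oneMinusQpow a ∣ₚ oneMinusQpow b
  oneMinusQpow-∣ {a} (divides b refl) = oneMinusQpow-multiple a b

  Combination : Poly → Poly → Poly → Set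
  Combination a b c = ∃[ u ] ∃[ v ] (u *ₚ a +ₚ v *ₚ b ≋ c)

  combination-sym : ∀ {a b c} → Combination a b c → Combination b a c
  combination-sym {a} {b} (u , v , e) = v , u , ≋-trans (+-comm (v *ₚ b) (u *ₚ a)) e

  -- if g + y = x, then 1 - q^g = (1 - q^x) - q^g (1 - q^y); hence 1 - q^g
  -- lies in every ideal containing 1 - q^x and 1 - q^y
  combination-difference : ∀ {a b} g x y → g ℕ.+ y ≡ x →
    a ∣ₚ oneMinusQpow x → b ∣ₚ oneMinusQpow y → Combination a b (oneMinusQpow g)
  combination-difference {a} {b} g x y g+y≡x (u , ua) (v , vb) = u , negₚ (qpow g *ₚ v) , (begin
    u *ₚ a +ₚ negₚ (qpow g *ₚ v) *ₚ b             ≈⟨ regroup (u *ₚ a) (qpow g) v b ⟩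
    u *ₚ a +ₚ negₚ (qpow g *ₚ (v *ₚ b))           ≈⟨ +-cong ua (neg-cong (*-congˡ (qpow g) vb)) ⟩
    oneMinusQpow x +ₚ negₚ (qpow g *ₚ oneMinusQpow y)
      ≈⟨ +-congʳ (negₚ (qpow g *ₚ oneMinusQpow y)) (≋-trans (≡⇒≋ (cong oneMinusQpow (sym g+y≡x))) (oneMinusQpow-+ g y)) ⟩
    (oneMinusQpow g +ₚ qpow g *ₚ oneMinusQpow y) +ₚ negₚ (qpow g *ₚ oneMinusQpow y)
      ≈⟨ cancel (oneMinusQpow g) (qpow g *ₚ oneMinusQpow y) ⟩
    oneMinusQpow g                                ∎)
    where
    regroup : ∀ w x v b → w +ₚ negₚ (x *ₚ v) *ₚ b ≋ w +ₚ negₚ (x *ₚ (v *ₚ b))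
    regroup = solve-∀ ℤ[q]
    cancel : ∀ a b → (a +ₚ b) +ₚ negₚ b ≋ a
    cancel = solve-∀ ℤ[q]

  oneMinusQpow-bezout : ∀ a b → Combination (oneMinusQpow a) (oneMinusQpow b) (oneMinusQpow (gcd a b))
  oneMinusQpow-bezout a b with Bézout.identity (gcd-GCD a b)
  ... | Bézout.+- x y eq = combination-difference (gcd a b) (x ℕ.* a) (y ℕ.* b) eq
                             (oneMinusQpow-multiple a x) (oneMinusQpow-multiple b y)
  ... | Bézout.-+ x y eq = combination-sym (combination-difference (gcd a b) (y ℕ.* b) (x ℕ.* a) eq
                             (oneMinusQpow-multiple b y) (oneMinusQpow-multiple a x))

-- The formal derivative, and the separability of 1 - q^N: any two
-- complementary factors of 1 - q^N generate an ideal containing the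
-- constant N, because N (1 - q^N) - q (1 - q^N)' = N.
module Separability where

  open PolynomialRing
  open PowersOfQ
  open import Data.Nat as ℕ using (zero; suc)
  open import Data.Integer using (+_; -_; _+_; _*_)
  import Data.Integer.Properties as ℤP
  open import Algebra.Properties.CommutativeSemigroup ℤP.*-commutativeSemigroup using (x∙yz≈y∙xz)
  open import Data.List using ([]; _∷_; map)
  open import Data.Product using (_,_)
  open import Relation.Binary.PropositionalEquality using (_≡_; refl; sym; trans; cong; cong₂; module ≡-Reasoning)
  open import Tactic.RingSolver using (solve-∀)

  der : Poly → Poly
  der []      = []
  der (a ∷ p) = p +ₚ (+ 0 ∷ der p)

  coeff-der : ∀ p i → coeff (der p) i ≡ + suc i * coeff p (suc i)
  coeff-der []      i       = sym (ℤP.*-zeroʳ (+ suc i))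
  coeff-der (a ∷ p) zero    = trans (coeff-+ p (+ 0 ∷ der p) 0) (trans (ℤP.+-identityʳ _) (sym (ℤP.*-identityˡ _)))
  coeff-der (a ∷ p) (suc i) = begin
    coeff (p +ₚ (+ 0 ∷ der p)) (suc i)           ≡⟨ coeff-+ p (+ 0 ∷ der p) (suc i) ⟩
    coeff p (suc i) + coeff (der p) i            ≡⟨ cong (_+_ (coeff p (suc i))) (coeff-der p i) ⟩
    coeff p (suc i) + + suc i * coeff p (suc i)  ≡⟨ cong (_+ (+ suc i * coeff p (suc i))) (sym (ℤP.*-identityˡ (coeff p (suc i)))) ⟩
    + 1 * coeff p (suc i) + + suc i * coeff p (suc i) ≡⟨ sym (ℤP.*-distribʳ-+ (coeff p (suc i)) (+ 1) (+ suc i)) ⟩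
    + suc (suc i) * coeff p (suc (suc i) ℕ.∸ 1)  ∎
    where open ≡-Reasoning

  der-≋ : ∀ p r → (∀ i → + suc i * coeff p (suc i) ≡ coeff r i) → der p ≋ r
  der-≋ p r h = mk λ i → trans (coeff-der p i) (h i)

  der-cong : ∀ {p r} → p ≋ r → der p ≋ der r
  der-cong {p} {r} (mk e) = der-≋ p (der r) λ i →
    trans (cong (+ suc i *_) (e (suc i))) (sym (coeff-der r i))

  der-+ : ∀ p r → der (p +ₚ r) ≋ der p +ₚ der r
  der-+ p r = der-≋ (p +ₚ r) (der p +ₚ der r) λ i → begin
    + suc i * coeff (p +ₚ r) (suc i)                        ≡⟨ cong (+ suc i *_) (coeff-+ p r (suc i)) ⟩
    + suc i * (coeff p (suc i) + coeff r (suc i))           ≡⟨ ℤP.*-distribˡ-+ (+ suc i) (coeff p (suc i)) (coeff r (suc i)) ⟩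
    + suc i * coeff p (suc i) + + suc i * coeff r (suc i)   ≡⟨ sym (cong₂ _+_ (coeff-der p i) (coeff-der r i)) ⟩
    coeff (der p) i + coeff (der r) i                       ≡⟨ sym (coeff-+ (der p) (der r) i) ⟩
    coeff (der p +ₚ der r) i                                ∎
    where open ≡-Reasoning

  der-neg : ∀ p → der (negₚ p) ≋ negₚ (der p)
  der-neg p = der-≋ (negₚ p) (negₚ (der p)) λ i → begin
    + suc i * coeff (negₚ p) (suc i)   ≡⟨ cong (+ suc i *_) (coeff-neg p (suc i)) ⟩
    + suc i * - coeff p (suc i)        ≡⟨ sym (ℤP.neg-distribʳ-* (+ suc i) (coeff p (suc i))) ⟩
    - (+ suc i * coeff p (suc i))      ≡⟨ cong -_ (sym (coeff-der p i)) ⟩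
    - coeff (der p) i                  ≡⟨ sym (coeff-neg (der p) i) ⟩
    coeff (negₚ (der p)) i             ∎
    where open ≡-Reasoning

  der-scale : ∀ a p → der (map (a *_) p) ≋ map (a *_) (der p)
  der-scale a p = der-≋ (map (a *_) p) (map (a *_) (der p)) λ i → begin
    + suc i * coeff (map (a *_) p) (suc i)   ≡⟨ cong (+ suc i *_) (coeff-scale a p (suc i)) ⟩
    + suc i * (a * coeff p (suc i))          ≡⟨ x∙yz≈y∙xz (+ suc i) a (coeff p (suc i)) ⟩
    a * (+ suc i * coeff p (suc i))          ≡⟨ cong (a *_) (sym (coeff-der p i)) ⟩
    a * coeff (der p) i                      ≡⟨ sym (coeff-scale a (der p) i) ⟩
    coeff (map (a *_) (der p)) i             ∎
    where open ≡-Reasoning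

  der-shift : ∀ p → der (+ 0 ∷ p) ≋ p +ₚ qₚ *ₚ der p
  der-shift p = +-congˡ p (shift≋q* (der p))

  der-* : ∀ p r → der (p *ₚ r) ≋ der p *ₚ r +ₚ p *ₚ der r
  der-* []      r = ≋-refl
  der-* (a ∷ p) r = begin
    der (map (a *_) r +ₚ (+ 0 ∷ p *ₚ r))
      ≈⟨ der-+ (map (a *_) r) (+ 0 ∷ p *ₚ r) ⟩
    der (map (a *_) r) +ₚ der (+ 0 ∷ p *ₚ r)
      ≈⟨ +-cong (≋-trans (der-scale a r) (scale≋cst* a (der r))) (der-shift (p *ₚ r)) ⟩
    cst a *ₚ der r +ₚ (p *ₚ r +ₚ qₚ *ₚ der (p *ₚ r))
      ≈⟨ +-congˡ (cst a *ₚ der r) (+-congˡ (p *ₚ r) (*-congˡ qₚ (der-* p r))) ⟩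
    cst a *ₚ der r +ₚ (p *ₚ r +ₚ qₚ *ₚ (der p *ₚ r +ₚ p *ₚ der r))
      ≈⟨ regroup (cst a) p r (der p) (der r) qₚ ⟩
    (p +ₚ qₚ *ₚ der p) *ₚ r +ₚ (cst a +ₚ qₚ *ₚ p) *ₚ der r
      ≈⟨ ≋-sym (+-cong (*-congʳ r (der-shift p)) (*-congʳ (der r) (cons≋ a p))) ⟩
    (p +ₚ (+ 0 ∷ der p)) *ₚ r +ₚ (a ∷ p) *ₚ der r
      ∎
    where
    open ≋-Reasoning
    cons≋ : ∀ a p → a ∷ p ≋ cst a +ₚ qₚ *ₚ p
    cons≋ a p = ≋-trans (cons-cong (sym (ℤP.+-identityʳ a)) ≋-refl) (+-congˡ (cst a) (shift≋q* p))
    regroup : ∀ c p r dp dr x → c *ₚ dr +ₚ (p *ₚ r +ₚ x *ₚ (dp *ₚ r +ₚ p *ₚ dr))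
                              ≋ (p +ₚ x *ₚ dp) *ₚ r +ₚ (c +ₚ x *ₚ p) *ₚ dr
    regroup = solve-∀ ℤ[q]

  der-qpow : ∀ m → der (qpow m) *ₚ qₚ ≋ cst (+ m) *ₚ qpow m
  der-qpow zero    = mk λ { zero → refl ; (suc zero) → refl ; (suc (suc i)) → refl }
  der-qpow (suc m) = begin
    der (+ 0 ∷ qpow m) *ₚ qₚ                   ≈⟨ *-congʳ qₚ (der-shift (qpow m)) ⟩
    (qpow m +ₚ qₚ *ₚ der (qpow m)) *ₚ qₚ       ≈⟨ regroup (qpow m) (der (qpow m)) qₚ ⟩
    qₚ *ₚ qpow m +ₚ qₚ *ₚ (der (qpow m) *ₚ qₚ) ≈⟨ +-congˡ (qₚ *ₚ qpow m) (*-congˡ qₚ (der-qpow m)) ⟩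
    qₚ *ₚ qpow m +ₚ qₚ *ₚ (cst (+ m) *ₚ qpow m) ≈⟨ collect qₚ (cst (+ m)) (qpow m) ⟩
    (oneₚ +ₚ cst (+ m)) *ₚ (qₚ *ₚ qpow m)       ≈⟨ *-congˡ (cst (+ suc m)) (≋-sym (shift≋q* (qpow m))) ⟩
    cst (+ suc m) *ₚ qpow (suc m)               ∎
    where
    open ≋-Reasoning
    regroup : ∀ x d q → (x +ₚ q *ₚ d) *ₚ q ≋ q *ₚ x +ₚ q *ₚ (d *ₚ q)
    regroup = solve-∀ ℤ[q]
    collect : ∀ q c x → q *ₚ x +ₚ q *ₚ (c *ₚ x) ≋ (oneₚ +ₚ c) *ₚ (q *ₚ x)
    collect = solve-∀ ℤ[q]

  der-oneMinusQpow : ∀ N → der (oneMinusQpow N) *ₚ qₚ ≋ negₚ (cst (+ N) *ₚ qpow N)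
  der-oneMinusQpow N = begin
    der (oneₚ +ₚ negₚ (qpow N)) *ₚ qₚ             ≈⟨ *-congʳ qₚ (der-+ oneₚ (negₚ (qpow N))) ⟩
    (der oneₚ +ₚ der (negₚ (qpow N))) *ₚ qₚ       ≈⟨ *-congʳ qₚ (+-cong der-one (der-neg (qpow N))) ⟩
    ([] +ₚ negₚ (der (qpow N))) *ₚ qₚ             ≈⟨ regroup (der (qpow N)) qₚ ⟩
    negₚ (der (qpow N) *ₚ qₚ)                     ≈⟨ neg-cong (der-qpow N) ⟩
    negₚ (cst (+ N) *ₚ qpow N)                    ∎
    where
    open ≋-Reasoning
    der-one : der oneₚ ≋ []
    der-one = mk λ { zero → refl ; (suc i) → refl }
    regroup : ∀ d q → ([] +ₚ negₚ d) *ₚ q ≋ negₚ (d *ₚ q)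
    regroup = solve-∀ ℤ[q]

  -- If a b = 1 - q^N then N = (N b - q b') a - (q a') b lies in the ideal (a, b).
  -- This is the separability of 1 - q^N, used to show that distinct
  -- cyclotomic factors are coprime up to an integer constant.
  oneMinusQpow-separable : ∀ N a b → a *ₚ b ≋ oneMinusQpow N → Combination a b (cst (+ N))
  oneMinusQpow-separable N a b ab≋ =
    cst (+ N) *ₚ b +ₚ negₚ (der b *ₚ qₚ) , negₚ (der a *ₚ qₚ) , ≋-sym (begin
    cst (+ N)
      ≈⟨ expand (cst (+ N)) (qpow N) ⟩
    cst (+ N) *ₚ oneMinusQpow N +ₚ negₚ (negₚ (cst (+ N) *ₚ qpow N))
      ≈⟨ +-congˡ (cst (+ N) *ₚ oneMinusQpow N) (neg-cong (≋-sym (der-oneMinusQpow N))) ⟩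
    cst (+ N) *ₚ oneMinusQpow N +ₚ negₚ (der (oneMinusQpow N) *ₚ qₚ)
      ≈⟨ ≋-sym (+-cong (*-congˡ (cst (+ N)) ab≋) (neg-cong (*-congʳ qₚ (der-cong ab≋)))) ⟩
    cst (+ N) *ₚ (a *ₚ b) +ₚ negₚ (der (a *ₚ b) *ₚ qₚ)
      ≈⟨ +-congˡ (cst (+ N) *ₚ (a *ₚ b)) (neg-cong (*-congʳ qₚ (der-* a b))) ⟩
    cst (+ N) *ₚ (a *ₚ b) +ₚ negₚ ((der a *ₚ b +ₚ a *ₚ der b) *ₚ qₚ)
      ≈⟨ regroup (cst (+ N)) a b (der a) (der b) qₚ ⟩
    (cst (+ N) *ₚ b +ₚ negₚ (der b *ₚ qₚ)) *ₚ a +ₚ negₚ (der a *ₚ qₚ) *ₚ b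
      ∎)
    where
    open ≋-Reasoning
    expand : ∀ c x → c ≋ c *ₚ (oneₚ +ₚ negₚ x) +ₚ negₚ (negₚ (c *ₚ x))
    expand = solve-∀ ℤ[q]
    regroup : ∀ c a b da db q → c *ₚ (a *ₚ b) +ₚ negₚ ((da *ₚ b +ₚ a *ₚ db) *ₚ q)
                                ≋ (c *ₚ b +ₚ negₚ (db *ₚ q)) *ₚ a +ₚ negₚ (da *ₚ q) *ₚ b
    regroup = solve-∀ ℤ[q]

-- Dividing out an integer constant: if q has constant term 1 and q divides
-- C n in ℤ[q] (C a positive integer), then q divides n. The quotient p of
-- C n by q has all coefficients divisible by C, as one sees by comparing
-- coefficients of q p = C n from the bottom up.
module ConstantCancellation where

  open PolynomialRing
  open PowersOfQ
  open import Data.Nat as ℕ using (zero; suc; _∸_; z≤n; s≤s)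
  import Data.Nat.Properties as ℕP
  open import Data.Integer using (+_; _+_; _*_)
  import Data.Integer.Properties as ℤP
  open import Data.Integer.Divisibility.Signed
    using (_∣_; divides; quotient; ∣m+n∣n⇒∣m; ∣n⇒∣m*n; ∣m∣n⇒∣m+n)
  open import Data.List using ([]; _∷_)
  open import Data.Product using (_,_)
  open import Data.Sum using (inj₁; inj₂)
  open import Function using (_∘_)
  open import Relation.Binary.PropositionalEquality using (_≡_; refl; sym; trans; cong; subst)

  sumTo-∣ : ∀ {c} f i → (∀ j → j ≤ i → c ∣ f j) → c ∣ sumTo f i
  sumTo-∣ f zero    h = h 0 z≤n
  sumTo-∣ f (suc i) h = ∣m∣n⇒∣m+n (h 0 z≤n) (sumTo-∣ (f ∘ suc) i (λ j j≤i → h (suc j) (s≤s j≤i)))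

  -- if q₀ = 1 and c divides every coefficient of q p, then c divides every
  -- coefficient of p: pᵢ = (q p)ᵢ - Σ_{j<i} q_{i-j} pⱼ
  coeffs-∣ : ∀ {c} q p → coeff q 0 ≡ + 1 → (∀ i → c ∣ coeff (q *ₚ p) i) → ∀ i → c ∣ coeff p i
  coeffs-∣ {c} q p q₀≡1 c∣qp i = below i i ℕP.≤-refl
    where
    leading : ∀ i → coeff q 0 * coeff p i ≡ coeff p i
    leading i = trans (cong (_* coeff p i) q₀≡1) (ℤP.*-identityˡ (coeff p i))
    below : ∀ i j → j ≤ i → c ∣ coeff p j
    below zero    zero    z≤n = subst (c ∣_) (trans (coeff-* q p 0) (leading 0)) (c∣qp 0)
    below (suc i) j j≤1+i with ℕP.m≤n⇒m<n∨m≡n j≤1+i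
    ... | inj₁ j<1+i = below i j (ℕP.≤-pred j<1+i)
    ... | inj₂ refl  = ∣m+n∣n⇒∣m (subst (c ∣_) split (c∣qp (suc i))) lower
      where
      rest = sumTo (λ j → coeff q (suc j) * coeff p (i ∸ j)) i
      lower : c ∣ rest
      lower = sumTo-∣ _ i (λ j _ → ∣n⇒∣m*n (coeff q (suc j)) (below i (i ∸ j) (ℕP.m∸n≤m i j)))
      split : coeff (q *ₚ p) (suc i) ≡ coeff p (suc i) + rest
      split = trans (coeff-* q p (suc i)) (cong (_+ rest) (leading (suc i)))

  exactQuotient : ∀ {c} (p : Poly) → (∀ i → c ∣ coeff p i) → Poly
  exactQuotient []      _ = []
  exactQuotient (a ∷ p) h = quotient (h 0) ∷ exactQuotient p (h ∘ suc)

  exactQuotient-correct : ∀ c p h → cst c *ₚ exactQuotient {c} p h ≋ p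
  exactQuotient-correct c p h = mk λ i → trans (coeff-cst* c (exactQuotient p h) i) (sym (correct p h i))
    where
    correct : ∀ p h i → coeff p i ≡ c * coeff (exactQuotient {c} p h) i
    correct []      h i       = sym (ℤP.*-zeroʳ c)
    correct (a ∷ p) h zero    = trans (_∣_.equality (h 0)) (ℤP.*-comm (quotient (h 0)) c)
    correct (a ∷ p) h (suc i) = correct p (h ∘ suc) i

  cst-cancel : ∀ c {a b} → cst (+ suc c) *ₚ a ≋ cst (+ suc c) *ₚ b → a ≋ b
  cst-cancel c {a} {b} (mk e) = mk λ i → ℤP.*-cancelˡ-≡ (+ suc c) (coeff a i) (coeff b i)
    (trans (sym (coeff-cst* (+ suc c) a i)) (trans (e i) (coeff-cst* (+ suc c) b i)))

  -- opaque: only the existence of the quotient matters, and unfolding its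
  -- construction during type checking is needlessly expensive
  opaque
    cancel-constant : ∀ c {q n} → coeff q 0 ≡ + 1 → q ∣ₚ cst (+ suc c) *ₚ n → q ∣ₚ n
    cancel-constant c {q} {n} q₀≡1 (p , pq≋Cn) =
      let C   = + suc c
          C∣p = coeffs-∣ q p q₀≡1 λ i → divides (coeff n i)
                  (trans (get (≋-trans (*-comm q p) pq≋Cn) i) (trans (coeff-cst* C n i) (ℤP.*-comm C (coeff n i))))
          p′  = exactQuotient p C∣p
      in p′ , cst-cancel c (≋-trans (≋-sym (*-assoc (cst C) p′ q))
                             (≋-trans (*-congʳ q (exactQuotient-correct C p C∣p)) pq≋Cn))

module ExponentProducts where

  open PolynomialRing
  open PowersOfQ
  open import Data.Nat as ℕ using (zero; suc; _<_; _∸_; z≤n; s≤s)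
  import Data.Nat.Properties as ℕP
  open import Data.Nat.Divisibility using (_∣_; _∣?_; ∣-trans; ∣⇒≤)
  open import Data.Integer using (+_; _*_)
  open import Data.Product using (_,_)
  open import Data.Sum using (inj₁; inj₂)
  open import Data.Empty using (⊥-elim)
  open import Relation.Nullary using (yes; no; ¬_)
  open import Relation.Binary.PropositionalEquality using (_≡_; refl; trans; cong; cong₂)
  open import Tactic.RingSolver using (solve-∀)

  powₚ : Poly → ℕ → Poly
  powₚ x zero    = oneₚ
  powₚ x (suc e) = x *ₚ powₚ x e

  pow-+ : ∀ x a b → powₚ x (a ℕ.+ b) ≋ powₚ x a *ₚ powₚ x b
  pow-+ x zero    b = ≋-sym (*-identityˡ (powₚ x b))
  pow-+ x (suc a) b = ≋-trans (*-congˡ x (pow-+ x a b)) (≋-sym (*-assoc x (powₚ x a) (powₚ x b)))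

  pow-one : ∀ x → powₚ x 1 ≋ x
  pow-one x = ≋-trans (*-comm x oneₚ) (*-identityˡ x)

  coeff₀-* : ∀ a b → coeff a 0 ≡ + 1 → coeff b 0 ≡ + 1 → coeff (a *ₚ b) 0 ≡ + 1
  coeff₀-* a b a₀≡1 b₀≡1 = trans (coeff-* a b 0) (cong₂ _*_ a₀≡1 b₀≡1)

  pow-coeff₀ : ∀ x e → coeff x 0 ≡ + 1 → coeff (powₚ x e) 0 ≡ + 1
  pow-coeff₀ x zero    x₀≡1 = refl
  pow-coeff₀ x (suc e) x₀≡1 = coeff₀-* x (powₚ x e) x₀≡1 (pow-coeff₀ x e x₀≡1)

  prodFrom1-cong : ∀ n f g → (∀ m → 1 ≤ m → m ≤ n → f m ≋ g m) → prodFrom1 n f ≋ prodFrom1 n g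
  prodFrom1-cong zero    f g h = ≋-refl
  prodFrom1-cong (suc n) f g h = *-cong (prodFrom1-cong n f g λ m 1≤m m≤n → h m 1≤m (ℕP.m≤n⇒m≤1+n m≤n))
                                        (h (suc n) (s≤s z≤n) ℕP.≤-refl)

  prodFrom1-* : ∀ n f g → prodFrom1 n (λ m → f m *ₚ g m) ≋ prodFrom1 n f *ₚ prodFrom1 n g
  prodFrom1-* zero    f g = ≋-sym (*-identityˡ oneₚ)
  prodFrom1-* (suc n) f g = ≋-trans (*-congʳ (f (suc n) *ₚ g (suc n)) (prodFrom1-* n f g))
                                    (interchange (prodFrom1 n f) (prodFrom1 n g) (f (suc n)) (g (suc n)))
    where
    interchange : ∀ a b c d → (a *ₚ b) *ₚ (c *ₚ d) ≋ (a *ₚ c) *ₚ (b *ₚ d)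
    interchange = solve-∀ ℤ[q]

  prodFrom1-coeff₀ : ∀ n f → (∀ m → coeff (f m) 0 ≡ + 1) → coeff (prodFrom1 n f) 0 ≡ + 1
  prodFrom1-coeff₀ zero    f h = refl
  prodFrom1-coeff₀ (suc n) f h = coeff₀-* (prodFrom1 n f) (f (suc n)) (prodFrom1-coeff₀ n f h) (h (suc n))

  sumFrom1 : ℕ → (ℕ → ℕ) → ℕ
  sumFrom1 zero    g = 0
  sumFrom1 (suc n) g = sumFrom1 n g ℕ.+ g (suc n)

  Π : (ℕ → Poly) → ℕ → (ℕ → ℕ) → Poly
  Π Φ B E = prodFrom1 B (λ d → powₚ (Φ d) (E d))

  Π-+ : ∀ Φ B E E′ → Π Φ B (λ d → E d ℕ.+ E′ d) ≋ Π Φ B E *ₚ Π Φ B E′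
  Π-+ Φ B E E′ = ≋-trans (prodFrom1-cong B _ _ λ d _ _ → pow-+ (Φ d) (E d) (E′ d))
                         (prodFrom1-* B (λ d → powₚ (Φ d) (E d)) (λ d → powₚ (Φ d) (E′ d)))

  Π-zero : ∀ Φ B → Π Φ B (λ _ → 0) ≋ oneₚ
  Π-zero Φ zero    = ≋-refl
  Π-zero Φ (suc B) = ≋-trans (*-congʳ oneₚ (Π-zero Φ B)) (*-identityˡ oneₚ)

  Π-congΦ : ∀ Φ Φ′ B E → (∀ d → 1 ≤ d → d ≤ B → Φ d ≡ Φ′ d) → Π Φ B E ≋ Π Φ′ B E
  Π-congΦ Φ Φ′ B E h = prodFrom1-cong B _ _ λ d 1≤d d≤B → ≡⇒≋ (cong (λ x → powₚ x (E d)) (h d 1≤d d≤B))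

  Π-congE : ∀ Φ B E E′ → (∀ d → 1 ≤ d → d ≤ B → E d ≡ E′ d) → Π Φ B E ≋ Π Φ B E′
  Π-congE Φ B E E′ h = prodFrom1-cong B _ _ λ d 1≤d d≤B → ≡⇒≋ (cong (powₚ (Φ d)) (h d 1≤d d≤B))

  Π-extend : ∀ Φ E {B B′} → B ≤ B′ → (∀ d → B < d → d ≤ B′ → E d ≡ 0) → Π Φ B E ≋ Π Φ B′ E
  Π-extend Φ E {B′ = zero}   z≤n    h = ≋-refl
  Π-extend Φ E {B′ = suc B′} B≤1+B′ h with ℕP.m≤n⇒m<n∨m≡n B≤1+B′
  ... | inj₂ refl   = ≋-refl
  ... | inj₁ B<1+B′ = ≋-trans (Π-extend Φ E (ℕP.≤-pred B<1+B′) λ d B<d d≤B′ → h d B<d (ℕP.m≤n⇒m≤1+n d≤B′))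
    (≋-sym (≋-trans (*-congˡ (Π Φ B′ E) (≡⇒≋ (cong (powₚ (Φ (suc B′))) (h (suc B′) B<1+B′ ℕP.≤-refl))))
                    (≋-trans (*-comm (Π Φ B′ E) oneₚ) (*-identityˡ (Π Φ B′ E)))))

  Π-mono : ∀ Φ B E E′ → (∀ d → 1 ≤ d → d ≤ B → E d ≤ E′ d) → Π Φ B E ∣ₚ Π Φ B E′
  Π-mono Φ B E E′ h = Π Φ B (λ d → E′ d ∸ E d) ,
    ≋-trans (*-comm (Π Φ B (λ d → E′ d ∸ E d)) (Π Φ B E))
      (≋-trans (≋-sym (Π-+ Φ B E (λ d → E′ d ∸ E d)))
               (Π-congE Φ B _ _ λ d 1≤d d≤B → ℕP.m+[n∸m]≡n (h d 1≤d d≤B)))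

  Π-coeff₀ : ∀ Φ B E → (∀ d → coeff (Φ d) 0 ≡ + 1) → coeff (Π Φ B E) 0 ≡ + 1
  Π-coeff₀ Φ B E h = prodFrom1-coeff₀ B _ λ d → pow-coeff₀ (Φ d) (E d) (h d)

  δ : ℕ → ℕ → ℕ
  δ t d with d ∣? t
  ... | yes _ = 1
  ... | no  _ = 0

  δ-yes : ∀ {t d} → d ∣ t → δ t d ≡ 1
  δ-yes {t} {d} d∣t with d ∣? t
  ... | yes _   = refl
  ... | no  d∤t = ⊥-elim (d∤t d∣t)

  δ-no : ∀ {t d} → ¬ d ∣ t → δ t d ≡ 0
  δ-no {t} {d} d∤t with d ∣? t
  ... | yes d∣t = ⊥-elim (d∤t d∣t)
  ... | no  _   = refl

  δ-above : ∀ {t d} → 1 ≤ t → t < d → δ t d ≡ 0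
  δ-above {suc t} _ t<d = δ-no λ d∣t → ℕP.<⇒≱ t<d (∣⇒≤ d∣t)

  δ-mono : ∀ {t u} d → t ∣ u → δ t d ≤ δ u d
  δ-mono {t} {u} d t∣u with d ∣? t
  ... | no  _   = z≤n
  ... | yes d∣t rewrite δ-yes (∣-trans d∣t t∣u) = ℕP.≤-refl

-- Comaximality over ℤ: a and b are comaximal when some positive integer
-- lies in the ideal (a, b). Over ℚ this is coprimality; over ℤ it is what
-- lets pairwise comaximal divisors of m have a product dividing C m.
module Comaximality where

  open PolynomialRing
  open PowersOfQ
  open ExponentProducts using (powₚ)
  open import Data.Nat as ℕ using (zero; suc; _<_; z≤n; s≤s)
  import Data.Nat.Properties as ℕP
  open import Data.Integer using (+_)
  import Data.Integer.Properties as ℤP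
  open import Data.List using ([])
  open import Data.Product using (_,_)
  open import Relation.Binary.PropositionalEquality using (cong)
  open import Tactic.RingSolver using (solve-∀)
  open ≋-Reasoning

  Comaximal : Poly → Poly → Set
  Comaximal a b = ∃[ c ] Combination a b (cst (+ suc c))

  comaximal-sym : ∀ {a b} → Comaximal a b → Comaximal b a
  comaximal-sym (c , comb) = c , combination-sym comb

  comaximal-oneˡ : ∀ b → Comaximal oneₚ b
  comaximal-oneˡ b = 0 , oneₚ , [] , ≋-refl

  comaximal-∣ : ∀ {x a b} → Comaximal x b → a ∣ₚ b → Comaximal x a
  comaximal-∣ {x} {a} (c , u , v , e) (w , wa≋b) =
    c , u , v *ₚ w , ≋-trans (+-congˡ (u *ₚ x) (≋-trans (*-assoc v w a) (*-congˡ v wa≋b))) e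

  cst-suc-* : ∀ a b → cst (+ suc a) *ₚ cst (+ suc b) ≋ cst (+ suc (b ℕ.+ a ℕ.* suc b))
  cst-suc-* a b = ≋-sym (≋-trans (≡⇒≋ (cong cst (ℤP.pos-* (suc a) (suc b))))
                                 (scale≋cst* (+ suc a) (cst (+ suc b))))

  comaximal-* : ∀ {x a b} → Comaximal x a → Comaximal x b → Comaximal x (a *ₚ b)
  comaximal-* {x} {a} {b} (c₁ , u₁ , v₁ , e₁) (c₂ , u₂ , v₂ , e₂) =
    c₂ ℕ.+ c₁ ℕ.* suc c₂ , (u₁ *ₚ u₂) *ₚ x +ₚ (u₁ *ₚ v₂) *ₚ b +ₚ (v₁ *ₚ a) *ₚ u₂ , v₁ *ₚ v₂ , (begin
    ((u₁ *ₚ u₂) *ₚ x +ₚ (u₁ *ₚ v₂) *ₚ b +ₚ (v₁ *ₚ a) *ₚ u₂) *ₚ x +ₚ (v₁ *ₚ v₂) *ₚ (a *ₚ b)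
      ≈⟨ factor u₁ u₂ v₁ v₂ x a b ⟩
    (u₁ *ₚ x +ₚ v₁ *ₚ a) *ₚ (u₂ *ₚ x +ₚ v₂ *ₚ b)   ≈⟨ *-cong e₁ e₂ ⟩
    cst (+ suc c₁) *ₚ cst (+ suc c₂)               ≈⟨ cst-suc-* c₁ c₂ ⟩
    cst (+ suc (c₂ ℕ.+ c₁ ℕ.* suc c₂))             ∎)
    where
    factor : ∀ u₁ u₂ v₁ v₂ x a b →
      ((u₁ *ₚ u₂) *ₚ x +ₚ (u₁ *ₚ v₂) *ₚ b +ₚ (v₁ *ₚ a) *ₚ u₂) *ₚ x +ₚ (v₁ *ₚ v₂) *ₚ (a *ₚ b)
        ≋ (u₁ *ₚ x +ₚ v₁ *ₚ a) *ₚ (u₂ *ₚ x +ₚ v₂ *ₚ b)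
    factor = solve-∀ ℤ[q]

  comaximal-transfer : ∀ {f q d e g} → q *ₚ f ≋ d → Comaximal f q → Combination d e g → g ∣ₚ q →
    Comaximal f e
  comaximal-transfer {f} {q} {d} {e} {g} qf≋d (c , x , y , xf+yq≋c) (u , v , ud+ve≋g) (z , zg≋q) =
    c , x +ₚ ((y *ₚ z) *ₚ u) *ₚ q , (y *ₚ z) *ₚ v , (begin
    (x +ₚ ((y *ₚ z) *ₚ u) *ₚ q) *ₚ f +ₚ ((y *ₚ z) *ₚ v) *ₚ e
      ≈⟨ regroup x y z u q f v e ⟩
    x *ₚ f +ₚ (y *ₚ z) *ₚ (u *ₚ (q *ₚ f) +ₚ v *ₚ e)
      ≈⟨ +-congˡ (x *ₚ f) (*-congˡ (y *ₚ z) (+-congʳ (v *ₚ e) (*-congˡ u qf≋d))) ⟩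
    x *ₚ f +ₚ (y *ₚ z) *ₚ (u *ₚ d +ₚ v *ₚ e)
      ≈⟨ +-congˡ (x *ₚ f) (*-congˡ (y *ₚ z) ud+ve≋g) ⟩
    x *ₚ f +ₚ (y *ₚ z) *ₚ g
      ≈⟨ +-congˡ (x *ₚ f) (≋-trans (*-assoc y z g) (*-congˡ y zg≋q)) ⟩
    x *ₚ f +ₚ y *ₚ q
      ≈⟨ xf+yq≋c ⟩
    cst (+ suc c)
      ∎)
    where
    regroup : ∀ x y z u q f v e →
      (x +ₚ ((y *ₚ z) *ₚ u) *ₚ q) *ₚ f +ₚ ((y *ₚ z) *ₚ v) *ₚ e
        ≋ x *ₚ f +ₚ (y *ₚ z) *ₚ (u *ₚ (q *ₚ f) +ₚ v *ₚ e)
    regroup = solve-∀ ℤ[q]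

  infix 4 _∣ₚ⁺_
  _∣ₚ⁺_ : Poly → Poly → Set
  a ∣ₚ⁺ m = ∃[ c ] (a ∣ₚ cst (+ suc c) *ₚ m)

  ∣ₚ⇒∣ₚ⁺ : ∀ {a m} → a ∣ₚ m → a ∣ₚ⁺ m
  ∣ₚ⇒∣ₚ⁺ {a} {m} a∣m = 0 , ∣ₚ-respʳ (≋-sym (*-identityˡ m)) a∣m

  comaximal-∣ₚ⁺ : ∀ {a b m} → Comaximal a b → a ∣ₚ m → b ∣ₚ⁺ m → a *ₚ b ∣ₚ⁺ m
  comaximal-∣ₚ⁺ {a} {b} {m} (c₁ , u , v , ua+vb≋c₁) (z , za≋m) (c₂ , w , wb≋Cm) =
    c₂ ℕ.+ c₁ ℕ.* suc c₂ , u *ₚ w +ₚ v *ₚ (C₂ *ₚ z) , (begin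
    (u *ₚ w +ₚ v *ₚ (C₂ *ₚ z)) *ₚ (a *ₚ b)          ≈⟨ regroup u w v C₂ z a b ⟩
    (u *ₚ a) *ₚ (w *ₚ b) +ₚ (v *ₚ b) *ₚ (C₂ *ₚ (z *ₚ a))
      ≈⟨ +-cong (*-congˡ (u *ₚ a) wb≋Cm) (*-congˡ (v *ₚ b) (*-congˡ C₂ za≋m)) ⟩
    (u *ₚ a) *ₚ (C₂ *ₚ m) +ₚ (v *ₚ b) *ₚ (C₂ *ₚ m)    ≈⟨ ≋-sym (*-distribʳ (C₂ *ₚ m) (u *ₚ a) (v *ₚ b)) ⟩
    (u *ₚ a +ₚ v *ₚ b) *ₚ (C₂ *ₚ m)                  ≈⟨ *-congʳ (C₂ *ₚ m) ua+vb≋c₁ ⟩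
    cst (+ suc c₁) *ₚ (C₂ *ₚ m)                      ≈⟨ ≋-sym (*-assoc (cst (+ suc c₁)) C₂ m) ⟩
    (cst (+ suc c₁) *ₚ C₂) *ₚ m                      ≈⟨ *-congʳ m (cst-suc-* c₁ c₂) ⟩
    cst (+ suc (c₂ ℕ.+ c₁ ℕ.* suc c₂)) *ₚ m          ∎)
    where
    C₂ = cst (+ suc c₂)
    regroup : ∀ u w v c z a b → (u *ₚ w +ₚ v *ₚ (c *ₚ z)) *ₚ (a *ₚ b)
                                ≋ (u *ₚ a) *ₚ (w *ₚ b) +ₚ (v *ₚ b) *ₚ (c *ₚ (z *ₚ a))
    regroup = solve-∀ ℤ[q]

  comaximal-powʳ : ∀ {x b} j → Comaximal x b → Comaximal x (powₚ b j)
  comaximal-powʳ {x} zero    x⊥b = comaximal-sym (comaximal-oneˡ x)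
  comaximal-powʳ     (suc j) x⊥b = comaximal-* x⊥b (comaximal-powʳ j x⊥b)

  comaximal-pow : ∀ {a b} i j → Comaximal a b → Comaximal (powₚ a i) (powₚ b j)
  comaximal-pow i j a⊥b = comaximal-sym (comaximal-powʳ i (comaximal-sym (comaximal-powʳ j a⊥b)))

  comaximal-prodFrom1 : ∀ {x} B A → (∀ d → 1 ≤ d → d ≤ B → Comaximal x (A d)) → Comaximal x (prodFrom1 B A)
  comaximal-prodFrom1 {x} zero    A h = comaximal-sym (comaximal-oneˡ x)
  comaximal-prodFrom1     (suc B) A h =
    comaximal-* (comaximal-prodFrom1 B A λ d 1≤d d≤B → h d 1≤d (ℕP.m≤n⇒m≤1+n d≤B))
                (h (suc B) (s≤s z≤n) ℕP.≤-refl)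

  prodFrom1-∣ₚ⁺ : ∀ {m} B A → (∀ d e → 1 ≤ d → d < e → e ≤ B → Comaximal (A e) (A d)) →
    (∀ d → 1 ≤ d → d ≤ B → A d ∣ₚ m) → prodFrom1 B A ∣ₚ⁺ m
  prodFrom1-∣ₚ⁺ zero    A coprime divides = ∣ₚ⇒∣ₚ⁺ (one-∣ₚ _)
  prodFrom1-∣ₚ⁺ (suc B) A coprime divides with
    comaximal-∣ₚ⁺ (comaximal-prodFrom1 B A λ d 1≤d d≤B → coprime d (suc B) 1≤d (s≤s d≤B) ℕP.≤-refl)
                  (divides (suc B) (s≤s z≤n) ℕP.≤-refl)
                  (prodFrom1-∣ₚ⁺ B A (λ d e 1≤d d<e e≤B → coprime d e 1≤d d<e (ℕP.m≤n⇒m≤1+n e≤B))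
                                     (λ d 1≤d d≤B → divides d 1≤d (ℕP.m≤n⇒m≤1+n d≤B)))
  ... | c , A∣Cm = c , ∣ₚ-respˡ (*-comm (A (suc B)) (prodFrom1 B A)) A∣Cm

module Cyclotomic where

  open PolynomialRing
  open PowersOfQ
  open Separability using (oneMinusQpow-separable)
  open ConstantCancellation using (cancel-constant)
  open Comaximality
  open ExponentProducts
  open import Data.Nat as ℕ using (zero; suc; _<_; z≤n; s≤s)
  import Data.Nat.Properties as ℕP
  open import Data.Nat.Divisibility using (_∣_; _∣?_; ∣-refl; ∣⇒≤; 0∣⇒≡0)
  open import Data.Nat.GCD using (gcd; gcd[m,n]∣m; gcd[m,n]∣n)
  open import Data.Integer using (+_; _*_)
  import Data.Integer.Properties as ℤP
  open import Data.Product using (_,_; proj₁; proj₂)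
  open import Data.Sum using (inj₁; inj₂)
  open import Data.Empty using (⊥-elim)
  open import Relation.Nullary using (yes; no; ¬_)
  open import Relation.Binary.PropositionalEquality using (_≡_; _≢_; refl; sym; trans; cong; subst)

  divisorProduct : (ℕ → Poly) → ℕ → Poly
  divisorProduct Φ t = Π Φ t (δ t)

  record IsCyclotomic (Φ : ℕ → Poly) (N : ℕ) : Set where
    field
      constant-term : ∀ d → coeff (Φ d) 0 ≡ + 1
      factorisation : ∀ t → 1 ≤ t → t ≤ N → divisorProduct Φ t ≋ oneMinusQpow t

  divisorProduct-top : ∀ Φ t → divisorProduct Φ (suc t) ≋ Π Φ t (δ (suc t)) *ₚ Φ (suc t)
  divisorProduct-top Φ t = *-congˡ (Π Φ t (δ (suc t)))
    (≋-trans (≡⇒≋ (cong (powₚ (Φ (suc t))) (δ-yes (∣-refl {suc t})))) (pow-one (Φ (suc t))))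

  module _ {Φ N} (cyc : IsCyclotomic Φ N) where
    open IsCyclotomic cyc

    cofactor : ∀ t → suc t ≤ N → Π Φ t (δ (suc t)) *ₚ Φ (suc t) ≋ oneMinusQpow (suc t)
    cofactor t t<N = ≋-trans (≋-sym (divisorProduct-top Φ t)) (factorisation (suc t) (s≤s z≤n) t<N)

    Φ-∣ : ∀ t → 1 ≤ t → t ≤ N → Φ t ∣ₚ oneMinusQpow t
    Φ-∣ (suc t) _ t<N = Π Φ t (δ (suc t)) , cofactor t t<N

    -- Φ_e is comaximal with 1 - q^c whenever e does not divide c:
    -- with g = gcd(e, c) < e, the polynomial 1 - q^g lies in (1 - q^e, 1 - q^c)
    -- and divides the cofactor of Φ_e in 1 - q^e, which is comaximal with Φ_e.
    Φ-comaximal-oneMinusQpow : ∀ e c → 1 ≤ e → e ≤ N → ¬ e ∣ c → Comaximal (Φ e) (oneMinusQpow c)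
    Φ-comaximal-oneMinusQpow (suc e′) c _ e≤N e∤c =
      comaximal-transfer (cofactor e′ e≤N) Φe⊥cofactor (oneMinusQpow-bezout e c) g∣cofactor
      where
      e = suc e′
      Φe⊥cofactor : Comaximal (Φ e) (Π Φ e′ (δ e))
      Φe⊥cofactor = e′ , oneMinusQpow-separable e (Φ e) (Π Φ e′ (δ e))
                                              (≋-trans (*-comm (Φ e) _) (cofactor e′ e≤N))
      g = gcd e c
      g∣e : g ∣ e
      g∣e = gcd[m,n]∣m e c
      g<e : g < e
      g<e = ℕP.≤∧≢⇒< (∣⇒≤ g∣e) λ g≡e → e∤c (subst (_∣ c) g≡e (gcd[m,n]∣n e c))
      1≤g : 1 ≤ g
      1≤g = ℕP.n≢0⇒n>0 λ g≡0 → ℕP.1+n≢0 (0∣⇒≡0 (subst (_∣ e) g≡0 g∣e))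
      g∣cofactor : oneMinusQpow g ∣ₚ Π Φ e′ (δ e)
      g∣cofactor = ∣ₚ-respˡ (factorisation g 1≤g (ℕP.≤-trans (ℕP.<⇒≤ g<e) e≤N))
        (∣ₚ-respˡ (≋-sym (Π-extend Φ (δ g) (ℕP.≤-pred g<e) λ d g<d _ → δ-above 1≤g g<d))
          (Π-mono Φ e′ (δ g) (δ e) λ d _ _ → δ-mono d g∣e))

    Φ-comaximal : ∀ d e → 1 ≤ d → d < e → e ≤ N → Comaximal (Φ e) (Φ d)
    Φ-comaximal (suc d′) e _ d<e e≤N = comaximal-∣
      (Φ-comaximal-oneMinusQpow e (suc d′) (ℕP.≤-trans (s≤s z≤n) d<e) e≤N λ e∣d → ℕP.<⇒≱ d<e (∣⇒≤ e∣d))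
      (Φ-∣ (suc d′) (s≤s z≤n) (ℕP.≤-trans (ℕP.<⇒≤ d<e) e≤N))

  _[_≔_] : (ℕ → Poly) → ℕ → Poly → ℕ → Poly
  (Φ [ n ≔ p ]) d with d ℕ.≟ n
  ... | yes _ = p
  ... | no  _ = Φ d

  update-here : ∀ Φ n p → (Φ [ n ≔ p ]) n ≡ p
  update-here Φ n p with n ℕ.≟ n
  ... | yes _   = refl
  ... | no  n≢n = ⊥-elim (n≢n refl)

  update-elsewhere : ∀ Φ n p d → d ≢ n → (Φ [ n ≔ p ]) d ≡ Φ d
  update-elsewhere Φ n p d d≢n with d ℕ.≟ n
  ... | yes d≡n = ⊥-elim (d≢n d≡n)
  ... | no  _   = refl

  update-∀ : ∀ (P : Poly → Set) Φ n p → P p → (∀ d → P (Φ d)) → ∀ d → P ((Φ [ n ≔ p ]) d)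
  update-∀ P Φ n p Pp PΦ d with d ℕ.≟ n
  ... | yes _ = Pp
  ... | no  _ = PΦ d

  extend : ∀ {Φ N} → IsCyclotomic Φ N → ∃[ Φ′ ] IsCyclotomic Φ′ (suc N)
  extend {Φ} {N} cyc = Φ [ n ≔ p ] , record
    { constant-term = update-∀ (λ x → coeff x 0 ≡ + 1) Φ n p p₀≡1 constant-term
    ; factorisation = factorisation′ }
    where
    open IsCyclotomic cyc
    n = suc N
    A : ℕ → Poly
    A d = powₚ (Φ d) (δ n d)
    A-∣ : ∀ d → 1 ≤ d → d ≤ N → A d ∣ₚ oneMinusQpow n
    A-∣ d 1≤d d≤N with d ∣? n
    ... | yes d∣n = ∣ₚ-respˡ (≋-sym (pow-one (Φ d)))
                    (∣ₚ-trans (Φ-∣ cyc d 1≤d d≤N) (oneMinusQpow-∣ d∣n))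
    ... | no  _   = one-∣ₚ (oneMinusQpow n)
    A-comaximal : ∀ d e → 1 ≤ d → d < e → e ≤ N → Comaximal (A e) (A d)
    A-comaximal d e 1≤d d<e e≤N = comaximal-pow (δ n e) (δ n d) (Φ-comaximal cyc d e 1≤d d<e e≤N)
    Q = Π Φ N (δ n)
    Q₀≡1 : coeff Q 0 ≡ + 1
    Q₀≡1 = Π-coeff₀ Φ N (δ n) constant-term
    Q∣ : Q ∣ₚ oneMinusQpow n
    Q∣ = cancel-constant (proj₁ Q∣⁺) {Q} {oneMinusQpow n} Q₀≡1 (proj₂ Q∣⁺)
      where
      Q∣⁺ : Q ∣ₚ⁺ oneMinusQpow n
      Q∣⁺ = prodFrom1-∣ₚ⁺ N A A-comaximal A-∣
    p = proj₁ Q∣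
    pQ≋ : p *ₚ Q ≋ oneMinusQpow n
    pQ≋ = proj₂ Q∣
    p₀≡1 : coeff p 0 ≡ + 1
    p₀≡1 = trans (sym (ℤP.*-identityʳ (coeff p 0)))
                 (trans (cong (coeff p 0 *_) (sym Q₀≡1)) (trans (sym (coeff-* p Q 0)) (get pQ≋ 0)))
    agrees : ∀ t → t ≤ N → ∀ d → 1 ≤ d → d ≤ t → Φ d ≡ (Φ [ n ≔ p ]) d
    agrees t t≤N d _ d≤t = sym (update-elsewhere Φ n p d λ d≡n → ℕP.<-irrefl d≡n (s≤s (ℕP.≤-trans d≤t t≤N)))
    factorisation′ : ∀ t → 1 ≤ t → t ≤ n → divisorProduct (Φ [ n ≔ p ]) t ≋ oneMinusQpow t
    factorisation′ t 1≤t t≤n with ℕP.m≤n⇒m<n∨m≡n t≤n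
    ... | inj₁ t<n = ≋-trans (≋-sym (Π-congΦ Φ _ t (δ t) (agrees t (ℕP.≤-pred t<n))))
                             (factorisation t 1≤t (ℕP.≤-pred t<n))
    ... | inj₂ refl = begin
      divisorProduct (Φ [ n ≔ p ]) n         ≈⟨ divisorProduct-top (Φ [ n ≔ p ]) N ⟩
      Π (Φ [ n ≔ p ]) N (δ n) *ₚ (Φ [ n ≔ p ]) n
        ≈⟨ *-cong (≋-sym (Π-congΦ Φ _ N (δ n) (agrees N ℕP.≤-refl))) (≡⇒≋ (update-here Φ n p)) ⟩
      Q *ₚ p                                  ≈⟨ *-comm Q p ⟩
      p *ₚ Q                                  ≈⟨ pQ≋ ⟩
      oneMinusQpow n                          ∎
      where open ≋-Reasoning

  cyclotomic : ∀ N → ∃[ Φ ] IsCyclotomic Φ N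
  cyclotomic zero    = (λ _ → oneₚ) , record { constant-term = λ _ → refl ; factorisation = λ { (suc t) _ () } }
  cyclotomic (suc N) = extend (proj₂ (cyclotomic N))

-- The divisibility criterion: a product of factors 1 - q^t divides another
-- one as soon as, for every d, the number of exponents t divisible by d is
-- at most the corresponding number for the other product. Both products
-- are rewritten as products of cyclotomic polynomials and compared
-- exponentwise.
module Criterion where

  open PolynomialRing
  open PowersOfQ
  open ExponentProducts
  open Cyclotomic
  open import Data.Nat as ℕ using (suc)
  import Data.Nat.Properties as ℕP
  open import Data.Product using (_×_; proj₁; proj₂)

  pairProduct : ℕ → (ℕ → ℕ) → (ℕ → ℕ) → Poly
  pairProduct n a b = prodFrom1 n (λ m → oneMinusQpow (a m) *ₚ oneMinusQpow (b m))

  -- the number of exponents a m, b m (1 ≤ m ≤ n) divisible by d, which is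
  -- the exponent of Φ_d in pairProduct n a b
  multiplicity : ℕ → (ℕ → ℕ) → (ℕ → ℕ) → ℕ → ℕ
  multiplicity n a b d = sumFrom1 n (λ m → δ (a m) d ℕ.+ δ (b m) d)

  Bounded : ℕ → ℕ → (ℕ → ℕ) → Set
  Bounded B n a = ∀ m → 1 ≤ m → m ≤ n → 1 ≤ a m × a m ≤ B

  module _ {Φ B} (cyc : IsCyclotomic Φ B) where
    open IsCyclotomic cyc

    oneMinusQpow≋Π : ∀ t → 1 ≤ t → t ≤ B → oneMinusQpow t ≋ Π Φ B (δ t)
    oneMinusQpow≋Π t 1≤t t≤B = ≋-trans (≋-sym (factorisation t 1≤t t≤B))
                                       (Π-extend Φ (δ t) t≤B λ d t<d _ → δ-above 1≤t t<d)

    pairProduct≋Π : ∀ n a b → Bounded B n a → Bounded B n b → pairProduct n a b ≋ Π Φ B (multiplicity n a b)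
    pairProduct≋Π ℕ.zero  a b _   _   = ≋-sym (Π-zero Φ B)
    pairProduct≋Π (suc n) a b a∈B b∈B = begin
      pairProduct n a b *ₚ (oneMinusQpow (a (suc n)) *ₚ oneMinusQpow (b (suc n)))
        ≈⟨ *-cong (pairProduct≋Π n a b (below a∈B) (below b∈B))
                  (*-cong (top a∈B) (top b∈B)) ⟩
      Π Φ B (multiplicity n a b) *ₚ (Π Φ B (δ (a (suc n))) *ₚ Π Φ B (δ (b (suc n))))
        ≈⟨ *-congˡ (Π Φ B (multiplicity n a b)) (≋-sym (Π-+ Φ B (δ (a (suc n))) (δ (b (suc n))))) ⟩
      Π Φ B (multiplicity n a b) *ₚ Π Φ B (λ d → δ (a (suc n)) d ℕ.+ δ (b (suc n)) d)
        ≈⟨ ≋-sym (Π-+ Φ B (multiplicity n a b) _) ⟩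
      Π Φ B (multiplicity (suc n) a b)
        ∎
      where
      open ≋-Reasoning
      below : ∀ {c} → Bounded B (suc n) c → Bounded B n c
      below c∈B m 1≤m m≤n = c∈B m 1≤m (ℕP.m≤n⇒m≤1+n m≤n)
      top : ∀ {c} → Bounded B (suc n) c → oneMinusQpow (c (suc n)) ≋ Π Φ B (δ (c (suc n)))
      top {c} c∈B = oneMinusQpow≋Π (c (suc n)) (proj₁ bounds) (proj₂ bounds)
        where bounds = c∈B (suc n) (ℕ.s≤s ℕ.z≤n) ℕP.≤-refl

  quotient-criterion : ∀ B n a b a′ b′ → Bounded B n a → Bounded B n b → Bounded B n a′ → Bounded B n b′ →
    (∀ d → 1 ≤ d → d ≤ B → multiplicity n a b d ≤ multiplicity n a′ b′ d) →
    pairProduct n a b ∣ₚ pairProduct n a′ b′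
  quotient-criterion B n a b a′ b′ a∈B b∈B a′∈B b′∈B fewer =
    ∣ₚ-respʳ (≋-sym (pairProduct≋Π cyc n a′ b′ a′∈B b′∈B))
      (∣ₚ-respˡ (≋-sym (pairProduct≋Π cyc n a b a∈B b∈B))
        (Π-mono Φ B (multiplicity n a b) (multiplicity n a′ b′) fewer))
    where
    Φ = proj₁ (cyclotomic B)
    cyc = proj₂ (cyclotomic B)

module BlockSums where

  open ExponentProducts using (sumFrom1)
  open import Data.Nat using (zero; suc; _+_; _*_; _<_; NonZero; z≤n; s≤s)
  open import Data.Nat.Properties
  open import Data.Nat.Divisibility using (_∣_; n∣m*n; ∣m+n∣m⇒∣n; ∣⇒≤)
  open import Data.Nat.DivMod using (_%_; _/_; m≡m%n+[m/n]*n; m%n<n)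
  open import Data.Sum using (inj₁; inj₂)
  open import Relation.Nullary using (¬_)
  open import Relation.Binary.PropositionalEquality
  open import Algebra.Properties.CommutativeSemigroup +-commutativeSemigroup
    using () renaming (interchange to +-interchange)

  blockSum : ℕ → ℕ → (ℕ → ℕ) → ℕ
  blockSum a zero    g = 0
  blockSum a (suc r) g = blockSum a r g + g (a + suc r)

  sumFrom1-split : ∀ a r g → sumFrom1 (a + r) g ≡ sumFrom1 a g + blockSum a r g
  sumFrom1-split a zero    g = trans (cong (λ x → sumFrom1 x g) (+-identityʳ a)) (sym (+-identityʳ _))
  sumFrom1-split a (suc r) g = begin
    sumFrom1 (a + suc r) g                              ≡⟨ cong (λ x → sumFrom1 x g) (+-suc a r) ⟩
    sumFrom1 (a + r) g + g (suc (a + r))                ≡⟨ cong (_+ g (suc (a + r))) (sumFrom1-split a r g) ⟩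
    sumFrom1 a g + blockSum a r g + g (suc (a + r))     ≡⟨ +-assoc (sumFrom1 a g) _ _ ⟩
    sumFrom1 a g + (blockSum a r g + g (suc (a + r)))   ≡⟨ cong (λ x → sumFrom1 a g + (blockSum a r g + g x)) (sym (+-suc a r)) ⟩
    sumFrom1 a g + blockSum a (suc r) g                 ∎
    where open ≡-Reasoning

  sumFrom1-mono : ∀ a r g → sumFrom1 a g ≤ sumFrom1 (a + r) g
  sumFrom1-mono a r g = subst (sumFrom1 a g ≤_) (sym (sumFrom1-split a r g)) (m≤m+n _ _)

  blockSum-zero : ∀ a r g → (∀ i → 1 ≤ i → i ≤ r → g (a + i) ≡ 0) → blockSum a r g ≡ 0
  blockSum-zero a zero    g h = refl
  blockSum-zero a (suc r) g h = cong₂ _+_ (blockSum-zero a r g λ i 1≤i i≤r → h i 1≤i (m≤n⇒m≤1+n i≤r))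
                                          (h (suc r) (s≤s z≤n) ≤-refl)

  blockSum-+ : ∀ a r g h → blockSum a r (λ m → g m + h m) ≡ blockSum a r g + blockSum a r h
  blockSum-+ a zero    g h = refl
  blockSum-+ a (suc r) g h = trans (cong (_+ (g (a + suc r) + h (a + suc r))) (blockSum-+ a r g h))
                                   (+-interchange (blockSum a r g) (blockSum a r h) _ _)

  blockSum-≥ : ∀ a r g i → 1 ≤ i → i ≤ r → g (a + i) ≤ blockSum a r g
  blockSum-≥ a zero    g (suc i) _ ()
  blockSum-≥ a (suc r) g i 1≤i i≤1+r with m≤n⇒m<n∨m≡n i≤1+r
  ... | inj₂ refl  = m≤n+m _ _
  ... | inj₁ i<1+r = ≤-trans (blockSum-≥ a r g i 1≤i (≤-pred i<1+r)) (m≤m+n _ _)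

  blockSum-≥₂ : ∀ a r g i j → 1 ≤ i → i < j → j ≤ r → g (a + i) + g (a + j) ≤ blockSum a r g
  blockSum-≥₂ a zero    g (suc i) (suc j) _ _ ()
  blockSum-≥₂ a (suc r) g i j 1≤i i<j j≤1+r with m≤n⇒m<n∨m≡n j≤1+r
  ... | inj₂ refl  = +-monoˡ-≤ _ (blockSum-≥ a r g i 1≤i (≤-pred i<j))
  ... | inj₁ j<1+r = ≤-trans (blockSum-≥₂ a r g i j 1≤i i<j (≤-pred j<1+r)) (m≤m+n _ _)

  interior-not-multiple : ∀ w d i → 1 ≤ i → i < d → ¬ d ∣ w * d + i
  interior-not-multiple w d (suc i) _ i<d d∣wd+i = <⇒≱ i<d (∣⇒≤ (∣m+n∣m⇒∣n d∣wd+i (n∣m*n w)))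

  compare-by-blocks : ∀ d .{{_ : NonZero d}} n g h → (∀ m → ¬ d ∣ m → g m ≡ 0) →
    (∀ w → blockSum (w * d) d g ≤ blockSum (w * d) d h) → sumFrom1 n g ≤ sumFrom1 n h
  compare-by-blocks d n g h g-off blocks = begin
    sumFrom1 n g                ≡⟨ cong (λ x → sumFrom1 x g) n≡wd+r ⟩
    sumFrom1 (w * d + r) g      ≡⟨ sumFrom1-split (w * d) r g ⟩
    sumFrom1 (w * d) g + blockSum (w * d) r g
      ≡⟨ cong (sumFrom1 (w * d) g +_) (blockSum-zero (w * d) r g λ i 1≤i i≤r →
           g-off (w * d + i) (interior-not-multiple w d i 1≤i (<-≤-trans (s≤s i≤r) (m%n<n n d)))) ⟩
    sumFrom1 (w * d) g + 0      ≡⟨ +-identityʳ _ ⟩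
    sumFrom1 (w * d) g          ≤⟨ whole-blocks w ⟩
    sumFrom1 (w * d) h          ≤⟨ sumFrom1-mono (w * d) r h ⟩
    sumFrom1 (w * d + r) h      ≡⟨ cong (λ x → sumFrom1 x h) (sym n≡wd+r) ⟩
    sumFrom1 n h                ∎
    where
    open ≤-Reasoning
    r = n % d
    w = n / d
    n≡wd+r : n ≡ w * d + r
    n≡wd+r = trans (m≡m%n+[m/n]*n n d) (+-comm r (w * d))
    whole-blocks : ∀ w → sumFrom1 (w * d) g ≤ sumFrom1 (w * d) h
    whole-blocks zero    = z≤n
    whole-blocks (suc w) = begin
      sumFrom1 (d + w * d) g                      ≡⟨ cong (λ x → sumFrom1 x g) (+-comm d (w * d)) ⟩
      sumFrom1 (w * d + d) g                      ≡⟨ sumFrom1-split (w * d) d g ⟩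
      sumFrom1 (w * d) g + blockSum (w * d) d g   ≤⟨ +-mono-≤ (whole-blocks w) (blocks w) ⟩
      sumFrom1 (w * d) h + blockSum (w * d) d h   ≡⟨ sym (sumFrom1-split (w * d) d h) ⟩
      sumFrom1 (w * d + d) h                      ≡⟨ cong (λ x → sumFrom1 x h) (+-comm (w * d) d) ⟩
      sumFrom1 (d + w * d) h                      ∎

-- Each block (wd, (w+1)d] contains
-- exactly one multiple of d, so the denominator gets 2 per block; the
-- numerator gets at least 2 per block: if gcd(k, d) = 1, one m with d | km
-- and one with d | k(m-1)+1; otherwise two m with d | km.
module Counting where

  open ExponentProducts using (δ; δ-yes; δ-no)
  open BlockSums
  open Criterion using (multiplicity)
  open import Data.Nat
  open import Data.Nat.Properties
  open import Data.Nat.Divisibility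
    using (_∣_; divides; ∣-refl; ∣⇒≤; n∣m*n; ∣n⇒∣m*n; ∣m+n∣m⇒∣n; ∣m∣n⇒∣m+n; 0∣⇒≡0)
  open import Data.Nat.DivMod using (_%_; _/_; m≡m%n+[m/n]*n; m%n<n)
  open import Data.Nat.GCD using (gcd; gcd-GCD; gcd[m,n]∣m; gcd[m,n]∣n; module Bézout; module GCD)
  open import Data.Product using (_,_; _×_; proj₁; proj₂)
  open import Function using (id)
  open import Relation.Nullary using (Dec; yes; no; ¬_)
  open import Relation.Binary.PropositionalEquality
  open import Data.Nat.Tactic.RingSolver using (solve-∀)

  numerator₁ numerator₂ : ℕ → ℕ → ℕ
  numerator₁ k m = k * m
  numerator₂ k m = k * (m ∸ 1) + 1

  d∣block-end : ∀ w d → d ∣ w * d + d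
  d∣block-end w d = ∣m∣n⇒∣m+n (n∣m*n w) ∣-refl

  minus-one-multiple : ∀ k d′ → gcd k (suc d′) ≡ 1 → ∃[ x ] (suc d′ ∣ k * x + 1)
  minus-one-multiple k d′ coprime with Bézout.identity (subst (GCD.GCD k (suc d′)) coprime (gcd-GCD k (suc d′)))
  ... | Bézout.+- x y 1+yd≡xk = x * d′ , divides (1 + y * d′) (begin
    k * (x * d′) + 1             ≡⟨ reassociate k x d′ ⟩
    (x * k) * d′ + 1             ≡⟨ cong (λ z → z * d′ + 1) (sym 1+yd≡xk) ⟩
    (1 + y * suc d′) * d′ + 1    ≡⟨ factor y d′ ⟩
    (1 + y * d′) * suc d′        ∎)
    where
    open ≡-Reasoning
    reassociate : ∀ k x d → k * (x * d) + 1 ≡ (x * k) * d + 1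
    reassociate = solve-∀
    factor : ∀ y d → (1 + y * (1 + d)) * d + 1 ≡ (1 + y * d) * (1 + d)
    factor = solve-∀
  ... | Bézout.-+ x y 1+xk≡yd = x , divides y (trans (+-comm (k * x) 1) (trans (cong (1 +_) (*-comm k x)) 1+xk≡yd))

  reduced-minus-one-multiple : ∀ k d′ → gcd k (suc d′) ≡ 1 → ∃[ r ] (r < suc d′ × suc d′ ∣ k * r + 1)
  reduced-minus-one-multiple k d′ coprime with minus-one-multiple k d′ coprime
  ... | x , d∣kx+1 = x % d , m%n<n x d ,
    ∣m+n∣m⇒∣n (subst (d ∣_) split d∣kx+1) (n∣m*n (k * (x / d)))
    where
    d = suc d′
    split : k * x + 1 ≡ k * (x / d) * d + (k * (x % d) + 1)
    split = trans (cong (λ z → k * z + 1) (m≡m%n+[m/n]*n x d)) (regroup k (x % d) (x / d) d)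
      where
      regroup : ∀ k r q d → k * (r + q * d) + 1 ≡ k * q * d + (k * r + 1)
      regroup = solve-∀

  -- if gcd(k, d) ≠ 1 then d | k q for some 1 ≤ q < d, namely q = d / gcd(k, d)
  proper-multiple : ∀ k d′ → gcd k (suc d′) ≢ 1 → ∃[ q ] (1 ≤ q × q < suc d′ × suc d′ ∣ k * q)
  proper-multiple k d′ not-coprime
    with gcd[m,n]∣m k (suc d′) | gcd[m,n]∣n k (suc d′)
  ... | divides p k≡pg | divides q d≡qg = q , 1≤q , q<d , divides p (begin
    k * q             ≡⟨ cong (_* q) k≡pg ⟩
    p * g * q         ≡⟨ *-assoc p g q ⟩
    p * (g * q)       ≡⟨ cong (p *_) (trans (*-comm g q) (sym d≡qg)) ⟩
    p * suc d′        ∎)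
    where
    open ≡-Reasoning
    g = gcd k (suc d′)
    q≢0 : q ≢ 0
    q≢0 q≡0 = 1+n≢0 (trans d≡qg (cong (_* g) q≡0))
    1≤q : 1 ≤ q
    1≤q = n≢0⇒n>0 q≢0
    g≢0 : g ≢ 0
    g≢0 g≡0 = 1+n≢0 (trans d≡qg (trans (cong (q *_) g≡0) (*-zeroʳ q)))
    1<g : 1 < g
    1<g = ≤∧≢⇒< (n≢0⇒n>0 g≢0) (λ 1≡g → not-coprime (sym 1≡g))
    q<d : q < suc d′
    q<d = subst (q <_) (sym d≡qg) (m<m*n q g {{≢-nonZero q≢0}} 1<g)

  count₁ count₂ numerator-count : ℕ → ℕ → ℕ → ℕ
  count₁ k d m = δ (numerator₁ k m) d
  count₂ k d m = δ (numerator₂ k m) d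
  numerator-count k d m = count₁ k d m + count₂ k d m

  denominator-off : ∀ d m → ¬ d ∣ m → δ m d + δ m d ≡ 0
  denominator-off d m d∤m = cong₂ _+_ (δ-no d∤m) (δ-no d∤m)

  denominator-block : ∀ d′ w → blockSum (w * suc d′) (suc d′) (λ m → δ m (suc d′) + δ m (suc d′)) ≡ 2
  denominator-block d′ w = cong₂ _+_
    (blockSum-zero (w * d) d′ _ λ i 1≤i i≤d′ →
       denominator-off d (w * d + i) (interior-not-multiple w d i 1≤i (s≤s i≤d′)))
    (cong₂ _+_ end end)
    where
    d = suc d′
    end : δ (w * d + d) d ≡ 1
    end = δ-yes (d∣block-end w d)

  -- m = (w + 1) d: d | k m, so the first numerator exponent contributes
  block₁-end : ∀ k d′ w → 1 ≤ blockSum (w * suc d′) (suc d′) (count₁ k (suc d′))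
  block₁-end k d′ w = subst (_≤ blockSum (w * d) d (count₁ k d)) (δ-yes (∣n⇒∣m*n k (d∣block-end w d)))
                            (blockSum-≥ (w * d) d (count₁ k d) d (s≤s z≤n) ≤-refl)
    where d = suc d′

  -- if gcd(k, d) = 1, then m = w d + r + 1 with k r ≡ -1 (mod d) satisfies
  -- d | k (m - 1) + 1, so the second numerator exponent contributes
  block₂-coprime : ∀ k d′ w → gcd k (suc d′) ≡ 1 →
    1 ≤ blockSum (w * suc d′) (suc d′) (count₂ k (suc d′))
  block₂-coprime k d′ w coprime =
    let r , r<d , d∣kr+1 = reduced-minus-one-multiple k d′ coprime
        split : numerator₂ k (w * d + suc r) ≡ k * w * d + (k * r + 1)
        split = trans (cong (λ z → k * (z ∸ 1) + 1) (+-suc (w * d) r)) (regroup k w d r)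
    in subst (_≤ blockSum (w * d) d (count₂ k d))
         (δ-yes (subst (d ∣_) (sym split) (∣m∣n⇒∣m+n (n∣m*n (k * w)) d∣kr+1)))
         (blockSum-≥ (w * d) d (count₂ k d) (suc r) (s≤s z≤n) r<d)
    where
    d = suc d′
    regroup : ∀ k w d r → k * (w * d + r) + 1 ≡ k * w * d + (k * r + 1)
    regroup = solve-∀

  -- if gcd(k, d) ≠ 1, then d | k q for some 1 ≤ q < d, so both m = w d + q
  -- and m = (w + 1) d contribute to the first numerator exponent
  block₁-common-factor : ∀ k d′ w → gcd k (suc d′) ≢ 1 →
    2 ≤ blockSum (w * suc d′) (suc d′) (count₁ k (suc d′))
  block₁-common-factor k d′ w not-coprime =
    let q , 1≤q , q<d , d∣kq = proper-multiple k d′ not-coprime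
        split : k * (w * d + q) ≡ k * w * d + k * q
        split = trans (*-distribˡ-+ k (w * d) q) (cong (_+ k * q) (sym (*-assoc k w d)))
    in subst₂ (λ u v → u + v ≤ blockSum (w * d) d (count₁ k d))
         (δ-yes (subst (d ∣_) (sym split) (∣m∣n⇒∣m+n (n∣m*n (k * w)) d∣kq)))
         (δ-yes (∣n⇒∣m*n k (d∣block-end w d)))
         (blockSum-≥₂ (w * d) d (count₁ k d) q d 1≤q q<d ≤-refl)
    where d = suc d′

  numerator-block : ∀ k d′ w → 2 ≤ blockSum (w * suc d′) (suc d′) (numerator-count k (suc d′))
  numerator-block k d′ w =
    subst (2 ≤_) (sym (blockSum-+ (w * d) d (count₁ k d) (count₂ k d))) (by-gcd (gcd k d ≟ 1))
    where
    d = suc d′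
    by-gcd : Dec (gcd k d ≡ 1) → 2 ≤ blockSum (w * d) d (count₁ k d) + blockSum (w * d) d (count₂ k d)
    by-gcd (yes coprime)     = +-mono-≤ (block₁-end k d′ w) (block₂-coprime k d′ w coprime)
    by-gcd (no  not-coprime) = ≤-trans (block₁-common-factor k d′ w not-coprime) (m≤m+n _ _)

  multiplicity-inequality : ∀ k n d → 1 ≤ d →
    multiplicity n id id d ≤ multiplicity n (numerator₁ k) (numerator₂ k) d
  multiplicity-inequality k n (suc d′) _ =
    compare-by-blocks (suc d′) n _ _ (denominator-off (suc d′))
      λ w → subst (_≤ blockSum (w * suc d′) (suc d′) (numerator-count k (suc d′)))
                  (sym (denominator-block d′ w)) (numerator-block k d′ w)

module Exponents where

  open Criterion using (Bounded)
  open Counting using (numerator₁; numerator₂)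
  open import Data.Nat using (suc; _*_; _+_)
  open import Data.Nat.Properties
  open import Data.Product using (_,_)
  open import Function using (id)

  denominator-bounded : ∀ k n → 1 ≤ k → Bounded (k * n) n id
  denominator-bounded k@(suc _) n _ m 1≤m m≤n = 1≤m , ≤-trans m≤n (m≤n*m n k)

  numerator₁-bounded : ∀ k n → 1 ≤ k → Bounded (k * n) n (numerator₁ k)
  numerator₁-bounded k n 1≤k m 1≤m m≤n = *-mono-≤ 1≤k 1≤m , *-monoʳ-≤ k m≤n

  numerator₂-bounded : ∀ k n → 1 ≤ k → Bounded (k * n) n (numerator₂ k)
  numerator₂-bounded k n 1≤k (suc m) _ m<n = m≤n+m 1 (k * m) , (begin
    k * m + 1      ≤⟨ +-monoʳ-≤ (k * m) 1≤k ⟩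
    k * m + k      ≡⟨ +-comm (k * m) k ⟩
    k + k * m      ≡⟨ *-suc k m ⟨
    k * suc m      ≤⟨ *-monoʳ-≤ k m<n ⟩
    k * n          ∎)
    where open ≤-Reasoning

open PolynomialRing using (get)
open Criterion using (quotient-criterion)
open Counting using (numerator₁; numerator₂; multiplicity-inequality)
open Exponents
open import Data.Product using (_,_)
open import Function using (id)

-- Both are products of factors 1 - q^t with
-- exponents in [1, kn], so by the criterion it suffices that every d
-- divides the numerator exponents at least as often as the denominator ones.
theorem4p1 : (k : ℕ) → 1 ≤ k → (n : ℕ) → ∃[ P ] (P *ₚ denom n ≈ₚ numer n k)
theorem4p1 k 1≤k n with
  quotient-criterion (k ℕ.* n) n id id (numerator₁ k) (numerator₂ k)
    (denominator-bounded k n 1≤k) (denominator-bounded k n 1≤k)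
    (numerator₁-bounded k n 1≤k) (numerator₂-bounded k n 1≤k)
    (λ d 1≤d _ → multiplicity-inequality k n d 1≤d)
... | P , PD≋N = P , get PD≋N
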